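{- The labeling $\Lambda$ of the maximal chains of $W_{MN}$ is injective, for all $M,N\ge0$. Its image consists exactly of all sequences which are (multiset) permutations of multisets of the form $A\cup 2X\cup(\mathcal X\setminus X)$, where $A\subseteq\mathcal A$, $X\subseteq\mathcal X$, $|A|+|X|=M$, and $2X$ denotes the multiset consisting of two copies of each element of $X$ (so each letter of $A$ and of $\mathcal X\setminus X$ appears once and each letter of $X$ appears twice).
   Context: Let $\mathcal A=\{a_1,\dots,a_M\}$ (lower alphabet) and $\mathcal X=\{x_1,\dots,x_N\}$ (upper alphabet) be disjoint sets. A shuffle word is a (possibly empty) word with distinct letters from $\mathcal A\cup\mathcal X$ such that the letters from $\mathcal A$ in it appear in increasing order of subscripts, and likewise those from $\mathcal X$. The poset of shuffles $W_{MN}$ is the set of shuffle words ordered by the reflexive-transitive closure of the covering relation $w\lessdot w'$ iff $w'$ is obtained from $w$ by deleting one letter of $\mathcal A$ or inserting one letter of $\mathcal X$ (the result being a shuffle word). It has minimum $\hat0=a_1\cdots a_M$, maximum $\hat1=x_1\cdots x_N$ and every maximal chain has length $M+N$. The labeling $\Lambda$: for a maximal chain $c=(\hat0=w^0\lessdot w^1\lessdot\cdots\lessdot w^{M+N}=\hat1)$ set $\Lambda(c)=(\Lambda_1(c),\dots,\Lambda_{M+N}(c))\in(\mathcal A\cup\mathcal X)^{M+N}$, where for each $0\le i<M+N$: (x) if $w^{i+1}$ is obtained from $w^i$ by inserting $x_k\in\mathcal X$, then $\Lambda_{i+1}(c)=x_k$; (xa) if $w^i=u\,x_k\,a_m\,v$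 and $w^{i+1}=u\,x_k\,v$ (deletion of a letter $a_m$ located immediately after $x_k$), and this is the first covering step along $c$, starting from $\hat0$, in which a letter located immediately after $x_k$ is deleted, then $\Lambda_{i+1}(c)=x_k$; (a) if $w^{i+1}$ is obtained from $w^i$ by deleting $a_j\in\mathcal A$ and this deletion is not of type (xa), then $\Lambda_{i+1}(c)=a_j$. -}

module Defs where

open import Data.Nat using (ℕ; _<ᵇ_; _+_)
open import Data.Fin using (Fin; _<_)
open import Data.Fin.Properties using () renaming (_≟_ to _≟F_)
open import Data.Fin.Subset using (Subset; ∁; ∣_∣)
open import Data.Fin.Subset.Properties using (_∈?_)
open import Data.Sum using (_⊎_; inj₁; inj₂)
open import Data.Sum.Properties using (≡-dec)
open import Data.Maybe using (Maybe; just; nothing)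
open import Data.Bool using (if_then_else_)
open import Data.Product using (Σ; ∃; _×_; _,_)
open import Data.List using (List; []; _∷_; _++_; map; mapMaybe; allFin; filter; length; head; last)
open import Data.List.Relation.Unary.Any using (Any; any?)
open import Data.List.Relation.Unary.Linked using (Linked)
open import Data.List.Relation.Unary.Unique.Propositional using (Unique)
open import Data.List.Relation.Binary.Permutation.Propositional using (_↭_)
open import Relation.Binary.PropositionalEquality using (_≡_)
open import Relation.Nullary using (Dec; yes; no; does)

-- Letters: inj₁ m is a_{m}  (lower alphabet 𝒜 = {a_1..a_M}, indexed by Fin M),
--          inj₂ k is x_{k}  (upper alphabet 𝒳 = {x_1..x_N}, indexed by Fin N).
Letter : ℕ → ℕ → Set
Letter M N = Fin M ⊎ Fin N

Word : ℕ → ℕ → Set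
Word M N = List (Letter M N)

_≟L_ : ∀ {M N} (c d : Letter M N) → Dec (c ≡ d)
_≟L_ = ≡-dec _≟F_ _≟F_

isA : ∀ {M N} → Letter M N → Maybe (Fin M)
isA (inj₁ a) = just a
isA (inj₂ _) = nothing

isX : ∀ {M N} → Letter M N → Maybe (Fin N)
isX (inj₁ _) = nothing
isX (inj₂ x) = just x

IsShuffle : ∀ {M N} → Word M N → Set
IsShuffle w = Unique w × Linked _<_ (mapMaybe isA w) × Linked _<_ (mapMaybe isX w)

bot : ∀ M N → Word M N
bot M N = map inj₁ (allFin M)

top : ∀ M N → Word M N
top M N = map inj₂ (allFin N)

_⋖_ : ∀ {M N} → Word M N → Word M N → Set
_⋖_ {M} {N} w w' = IsShuffle w × IsShuffle w' ×
  ( (Σ (Word M N) λ u → Σ (Word M N) λ v → Σ (Fin M) λ a →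
        (w ≡ u ++ inj₁ a ∷ v) × (w' ≡ u ++ v))
  ⊎ (Σ (Word M N) λ u → Σ (Word M N) λ v → Σ (Fin N) λ x →
        (w ≡ u ++ v) × (w' ≡ u ++ inj₂ x ∷ v)) )

data Saturated {M N} : List (Word M N) → Set where
  single : ∀ {w} → Saturated (w ∷ [])
  step   : ∀ {w w' ws} → w ⋖ w' → Saturated (w' ∷ ws) → Saturated (w ∷ w' ∷ ws)

IsMaxChain : ∀ M N → List (Word M N) → Set
IsMaxChain M N ws = (head ws ≡ just (bot M N)) × (last ws ≡ just (top M N)) × Saturated ws

-- What happens in a covering step w ⋖ w', read off from the two words:
-- ins d     : the letter d is inserted
-- del c p   : the letter c is deleted, p is the letter immediately before it in w (if any)
data Change (M N : ℕ) : Set where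
  ins  : Letter M N → Change M N
  del  : Letter M N → Maybe (Letter M N) → Change M N
  none : Change M N

change : ∀ {M N} → Maybe (Letter M N) → Word M N → Word M N → Change M N
change p [] [] = none
change p [] (d ∷ _) = ins d
change p (c ∷ _) [] = del c p
change p (c ∷ w) (d ∷ w') with c ≟L d
... | yes _ = change (just c) w w'
... | no _ = if length w' <ᵇ length w then del c p else ins d

memN : ∀ {N} (x : Fin N) (used : List (Fin N)) → Dec (Any (x ≡_) used)
memN x used = any? (x ≟F_) used

-- label of one step, given the list of x_k for which a "letter immediately after x_k"
-- was already deleted earlier along the chain; returns label and updated list
stepLabel : ∀ {M N} → List (Fin N) → Change M N → Maybe (Letter M N) × List (Fin N)
stepLabel used (ins d) = just d , used
stepLabel used (del c (just (inj₂ x))) =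
  if does (memN x used) then (just c , used)
  else (just (inj₂ x) , x ∷ used)
stepLabel used (del c _) = just c , used
stepLabel used none = nothing , used

labelsFrom : ∀ {M N} → List (Fin N) → Word M N → List (Word M N) → List (Letter M N)
addLabel : ∀ {M N} → Maybe (Letter M N) × List (Fin N) → Word M N → List (Word M N) →
           List (Letter M N)
labelsFrom used w [] = []
labelsFrom used w (w' ∷ ws) = addLabel (stepLabel used (change nothing w w')) w' ws
addLabel (just ℓ , used') w' ws = ℓ ∷ labelsFrom used' w' ws
addLabel (nothing , used') w' ws = labelsFrom used' w' ws

Λ : ∀ {M N} → List (Word M N) → List (Letter M N)
Λ [] = []
Λ (w ∷ ws) = labelsFrom [] w ws

elems : ∀ {n} → Subset n → List (Fin n)
elems {n} p = filter (_∈? p) (allFin n)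

multisetList : ∀ {M N} → Subset M → Subset N → List (Letter M N)
multisetList A X =
  map inj₁ (elems A) ++ map inj₂ (elems X) ++ map inj₂ (elems X) ++ map inj₂ (elems (∁ X))

InImage : ∀ M N → List (Letter M N) → Set
InImage M N ℓ = Σ (Subset M) λ A → Σ (Subset N) λ X →
  (∣ A ∣ + ∣ X ∣ ≡ M) × (ℓ ↭ multisetList A X)

{-# OPTIONS --safe #-}
-- Follow a saturated chain from a word w up to 1̂, keeping track of the multiset κ of labels
-- still to come and of the set U of x-letters whose (xa) step has happened. The next label c
-- forces the kind of the next step: delete the a-letter c, let the present x-letter c delete
-- the a-letter after it, or insert the absent x-letter c.
--
-- The a-letters deleted by (xa) steps are matched, in order, with the x-letters performing
-- them: present unused x-letters with one label left, or absent ones with two labels left.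
-- Call κ feasible at (U, w) if, besides the evident bounds, this matching balances at every
-- present x-letter of w read from left to right. Feasibility is reflected by every covering
-- step, and a feasible κ ⊕ c is realised by exactly one step labelled c into a feasible
-- state; for an insertion the balance condition fixes the position. So maximal chains are
-- determined by their labels, and their label sequences are the orderings of the multisets
-- feasible at 0̂, which are exactly the A ∪ 2X ∪ (𝒳 ∖ X) with |A| + |X| = M.
module Submission where

open import Defs
open import Data.Nat using (ℕ; zero; suc; _+_; _∸_; _≤_; _<_; z≤n; s≤s; _≡ᵇ_; _<ᵇ_)
open import Data.Nat.Properties
open import Data.Bool using (Bool; true; false; not; _∧_; if_then_else_)
open import Data.Bool.Properties using (∧-identityʳ; ¬-not)
open import Data.Sum.Properties using (inj₁-injective; inj₂-injective)
open import Data.Fin using (Fin) renaming (zero to fzero; suc to fsuc; _<_ to _<ᶠ_; _≤_ to _≤ᶠ_)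
open import Data.Fin.Properties using ()
  renaming ( suc-injective to fsuc-injective; <-trans to <ᶠ-trans; <-irrefl to <ᶠ-irrefl
           ; <-asym to <ᶠ-asym; <-cmp to <ᶠ-cmp; _<?_ to _<ᶠ?_; _≟_ to _≟ᶠ_)
open import Data.Fin.Subset using (Subset; ∁; ∣_∣) renaming (_∈_ to _∈ˢ_)
open import Data.Fin.Subset.Properties using (_∈?_; ∣∁p∣≡n∸∣p∣)
open import Data.Vec using ([]; _∷_; tabulate)
open import Data.Sum using (inj₁; inj₂)
open import Data.Product using (Σ; ∃; ∃₂; _×_; _,_; proj₁; proj₂)
open import Data.Maybe using (Maybe; just; nothing)
open import Data.Unit using (⊤; tt)
open import Data.Empty using (⊥; ⊥-elim)
open import Data.List using (List; []; _∷_; _++_; map; mapMaybe; allFin; foldl; length; last)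
import Data.List as List
open import Data.Nat.ListAction using () renaming (sum to sumˡ)
open import Data.List.Properties
  using (mapMaybe-++; mapMaybe-map-retract; ++-assoc; map-tabulate; ∷-injective; ∷-injectiveˡ; ∷-injectiveʳ; ++-cancelˡ)
open import Data.List.Relation.Unary.All using (All; []; _∷_)
import Data.List.Relation.Unary.All as All
open import Data.List.Relation.Unary.All.Properties using (¬Any⇒All¬; All¬⇒¬Any) renaming (++⁻ˡ to All-++⁻ˡ)
open import Data.List.Relation.Unary.Any using (here; there)
open import Data.List.Relation.Unary.Linked as Linked using (Linked; []; [-]; _∷_)
open import Data.List.Relation.Unary.AllPairs using (_∷_)
open import Data.List.Relation.Unary.Linked.Properties using (Linked⇒All; AllPairs⇒Linked)
open import Data.List.Relation.Unary.AllPairs.Properties using (tabulate⁺-<)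
open import Data.List.Relation.Unary.Unique.Propositional using (Unique)
import Data.List.Relation.Unary.Unique.Propositional.Properties as Unique
open import Data.List.Membership.Propositional using (_∈_; _∉_)
open import Data.List.Membership.Propositional.Properties
  using (∈-++⁺ˡ; ∈-++⁺ʳ; ∈-insert; ∈-∃++; ∈-map⁺; ∈-map⁻; ∈-allFin; ∈-filter⁺; ∈-filter⁻)
open import Data.List.Relation.Binary.Permutation.Propositional using (_↭_; ↭-sym; ↭⇒↭ₛ)
import Data.List.Relation.Binary.Permutation.Propositional as ↭
open import Data.List.Relation.Binary.Permutation.Propositional.Properties using (shift; ∈-resp-↭)
import Data.List.Relation.Binary.Permutation.Setoid.Properties as Permutationₛ
open import Algebra.Properties.CommutativeSemigroup +-commutativeSemigroup using (xy∙z≈xz∙y)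
open import Algebra.Properties.CommutativeMonoid.Sum +-0-commutativeMonoid
  using (sum; sum-cong-≗; ∑-distrib-+; sum-replicate-zero)
open import Function.Bundles using (_⇔_; mk⇔; Equivalence)
open import Function.Properties.Equivalence using () renaming (trans to ⇔-trans; sym to ⇔-sym)
open import Relation.Nullary using (¬_; Dec; yes; no; does; _×-dec_)
open import Relation.Binary.Definitions using (DecidableEquality; Transitive; tri<; tri≈; tri>)
open import Relation.Binary.PropositionalEquality
open import Function using (_∘_; id)
open import Data.Nat.Tactic.RingSolver using (solve-∀)
open import Data.Product.Function.NonDependent.Propositional using (_×-⇔_)

module _ {A : Set} where

  private
    Unique-resp-↭ : ∀ {l m : List A} → l ↭ m → Unique l → Unique m
    Unique-resp-↭ p = Permutationₛ.Unique-resp-↭ (setoid A) (↭⇒↭ₛ p)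

  Unique-shift : ∀ u {c : A} {v} → Unique (u ++ c ∷ v) → Unique (c ∷ u ++ v)
  Unique-shift u = Unique-resp-↭ (shift _ u _)

  Unique-∉ : ∀ u {c : A} {v} → Unique (u ++ c ∷ v) → c ∉ u ++ v
  Unique-∉ u p = Unique.Unique[x∷xs]⇒x∉xs (Unique-shift u p)

  Unique-∉ˡ : ∀ u {c : A} {v} → Unique (u ++ c ∷ v) → c ∉ u
  Unique-∉ˡ u p m = Unique-∉ u p (∈-++⁺ˡ m)

  Unique-∉ʳ : ∀ u {c : A} {v} → Unique (u ++ c ∷ v) → c ∉ v
  Unique-∉ʳ u p m = Unique-∉ u p (∈-++⁺ʳ u m)

  Unique-delete : ∀ u {c : A} {v} → Unique (u ++ c ∷ v) → Unique (u ++ v)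
  Unique-delete u p with Unique-shift u p
  ... | _ ∷ q = q

  Unique-insert : ∀ u {c : A} {v} → Unique (u ++ v) → c ∉ u ++ v → Unique (u ++ c ∷ v)
  Unique-insert u p c∉ = Unique-resp-↭ (↭-sym (shift _ u _)) (¬Any⇒All¬ _ c∉ ∷ p)

  Unique-split : ∀ u₁ u₂ {c : A} {v₁ v₂} → Unique (u₁ ++ c ∷ v₁) →
                 u₁ ++ c ∷ v₁ ≡ u₂ ++ c ∷ v₂ → u₁ ≡ u₂ × v₁ ≡ v₂
  Unique-split []       []       _ refl = refl , refl
  Unique-split []       (d ∷ u₂) p refl = ⊥-elim (Unique-∉ [] p (∈-++⁺ʳ u₂ (here refl)))
  Unique-split (d ∷ u₁) []       p refl = ⊥-elim (Unique-∉ˡ (d ∷ u₁) p (here refl))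
  Unique-split (d ∷ u₁) (d′ ∷ u₂) (_ ∷ p) e with refl ← ∷-injectiveˡ e
    with refl , refl ← Unique-split u₁ u₂ p (∷-injectiveʳ e) = refl , refl

  ∈-delete : ∀ u {c d : A} {v} → d ∈ u ++ c ∷ v → d ≢ c → d ∈ u ++ v
  ∈-delete u m d≢c with ∈-resp-↭ (shift _ u _) m
  ... | here d≡c = ⊥-elim (d≢c d≡c)
  ... | there m′ = m′

  ∈-insert⁺ : ∀ u {c d : A} {v} → d ∈ u ++ v → d ∈ u ++ c ∷ v
  ∈-insert⁺ u m = ∈-resp-↭ (↭-sym (shift _ u _)) (there m)

module _ {A : Set} {R : A → A → Set} where

  Linked-insert : ∀ u {c v} → Linked R (u ++ v) → All (λ z → R z c) u → All (R c) v →
                  Linked R (u ++ c ∷ v)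
  Linked-insert []          {v = []}    _ _ _        = [-]
  Linked-insert []          {v = _ ∷ _} p _ (r ∷ _)  = r ∷ p
  Linked-insert (_ ∷ [])    p (r ∷ []) rs           = r ∷ Linked-insert [] (Linked.tail p) [] rs
  Linked-insert (_ ∷ _ ∷ u) (r ∷ p) (_ ∷ rs) rs′    = r ∷ Linked-insert (_ ∷ u) p rs rs′

  module _ (R-trans : Transitive R) where

    Linked-delete : ∀ u {c v} → Linked R (u ++ c ∷ v) → Linked R (u ++ v)
    Linked-delete []                [-]          = []
    Linked-delete []                (_ ∷ p)      = p
    Linked-delete (_ ∷ [])  {v = []}    _        = [-]
    Linked-delete (_ ∷ [])  {v = _ ∷ _} (r ∷ r′ ∷ p) = R-trans r r′ ∷ p
    Linked-delete (_ ∷ _ ∷ u)       (r ∷ p)      = r ∷ Linked-delete (_ ∷ u) p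

    Linked-split : ∀ u {c v} → Linked R (u ++ c ∷ v) → All (λ z → R z c) u × All (R c) v
    Linked-split []     {v = []}    _       = [] , []
    Linked-split []     {v = _ ∷ _} (r ∷ p) = [] , Linked⇒All R-trans r p
    Linked-split (d ∷ u)            p with Linked-split u (Linked.tail p)
    ... | below , above = head-below u p below ∷ below , above
      where
      head-below : ∀ l {c v} → Linked R (d ∷ l ++ c ∷ v) → All (λ z → R z c) l → R d c
      head-below []      (r ∷ _) _       = r
      head-below (_ ∷ _) (r ∷ _) (r′ ∷ _) = R-trans r r′

module _ {A : Set} {_≺_ : A → A → Set} (≺-trans : Transitive _≺_) (≺-irrefl : ∀ {a} → ¬ a ≺ a) where

  private
    below : ∀ {a l c} → Linked _≺_ (a ∷ l) → c ∈ l → a ≺ c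
    below (r ∷ sl) c∈l = All.lookup (Linked⇒All ≺-trans r sl) c∈l

    tail-⊆ : ∀ {a l m} → Linked _≺_ (a ∷ l) → (∀ {c} → c ∈ a ∷ l → c ∈ a ∷ m) →
             ∀ {c} → c ∈ l → c ∈ m
    tail-⊆ sl l⊆m c∈l with l⊆m (there c∈l)
    ... | here refl = ⊥-elim (≺-irrefl (below sl c∈l))
    ... | there c∈m = c∈m

  Linked-≡ : ∀ {l m} → Linked _≺_ l → Linked _≺_ m →
             (∀ {a} → a ∈ l → a ∈ m) → (∀ {a} → a ∈ m → a ∈ l) → l ≡ m
  Linked-≡ {[]}    {[]}    _  _  _   _   = refl
  Linked-≡ {[]}    {b ∷ m} _  _  _   m⊆l with () ← m⊆l (here refl)
  Linked-≡ {a ∷ l} {[]}    _  _  l⊆m _   with () ← l⊆m (here refl)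
  Linked-≡ {a ∷ l} {b ∷ m} sl sm l⊆m m⊆l with l⊆m (here refl) | m⊆l (here refl)
  ... | there a∈m | there b∈l = ⊥-elim (≺-irrefl (≺-trans (below sl b∈l) (below sm a∈m)))
  ... | there a∈m | here refl = ⊥-elim (≺-irrefl (below sm a∈m))
  ... | here refl | _ = cong (a ∷_) (Linked-≡ (Linked.tail sl) (Linked.tail sm) (tail-⊆ sl l⊆m) (tail-⊆ sm m⊆l))

allFin-sorted : ∀ n → Linked _<ᶠ_ (allFin n)
allFin-sorted n = AllPairs⇒Linked (tabulate⁺-< id)

false≢true : false ≢ true
false≢true ()

δ : ℕ → ℕ → ℕ
δ k n = if n ≡ᵇ k then 1 else 0

when : ∀ {P : Set} → Dec P → ℕ → ℕ
when (yes _) k = k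
when (no _)  _ = 0

when-yes : ∀ {P : Set} (d : Dec P) {k} → P → when d k ≡ k
when-yes (yes _) _ = refl
when-yes (no ¬p) p = ⊥-elim (¬p p)

when-no : ∀ {P : Set} (d : Dec P) {k} → ¬ P → when d k ≡ 0
when-no (yes p) ¬p = ⊥-elim (¬p p)
when-no (no _)  _  = refl

when-0 : ∀ {P : Set} (d : Dec P) → when d 0 ≡ 0
when-0 (yes _) = refl
when-0 (no _)  = refl

-- n₁ + b₂ ≡ n₂ + b₁ + t says n₁ − b₁ ≡ n₂ − b₂ + t without truncated subtraction.
module _ {t n₁ b₁ n₂ b₂ : ℕ} (shift : n₁ + b₂ ≡ n₂ + b₁ + t) where

  open ≡-Reasoning

  shift-check : ∀ {D₁ D₂} → D₁ ≡ D₂ + t → (n₁ ≡ D₁ + b₁) ⇔ (n₂ ≡ D₂ + b₂)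
  shift-check {D₂ = D₂} refl = mk⇔
    (λ n₁≡ → +-cancelʳ-≡ (b₁ + t) n₂ (D₂ + b₂) (begin
      n₂ + (b₁ + t)       ≡⟨ sym (+-assoc n₂ b₁ t) ⟩
      n₂ + b₁ + t         ≡⟨ sym shift ⟩
      n₁ + b₂             ≡⟨ cong (_+ b₂) n₁≡ ⟩
      D₂ + t + b₁ + b₂    ≡⟨ regroup₁ D₂ t b₁ b₂ ⟩
      D₂ + b₂ + (b₁ + t)  ∎))
    (λ n₂≡ → +-cancelʳ-≡ b₂ n₁ (D₂ + t + b₁) (begin
      n₁ + b₂             ≡⟨ shift ⟩
      n₂ + b₁ + t         ≡⟨ cong (λ n → n + b₁ + t) n₂≡ ⟩
      D₂ + b₂ + b₁ + t    ≡⟨ regroup₂ D₂ b₂ b₁ t ⟩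
      D₂ + t + b₁ + b₂    ∎))
    where
    regroup₁ : ∀ d t b₁ b₂ → d + t + b₁ + b₂ ≡ d + b₂ + (b₁ + t)
    regroup₁ = solve-∀
    regroup₂ : ∀ d b₂ b₁ t → d + b₂ + b₁ + t ≡ d + t + b₁ + b₂
    regroup₂ = solve-∀

  private
    shift-+ : ∀ i → n₁ + b₂ + i ≡ n₂ + b₁ + i + t
    shift-+ i = trans (cong (_+ i) shift) (xy∙z≈xz∙y (n₂ + b₁) t i)

  shift-+n : ∀ i → n₁ + i + b₂ ≡ n₂ + i + b₁ + t
  shift-+n i = begin
    n₁ + i + b₂      ≡⟨ xy∙z≈xz∙y n₁ i b₂ ⟩
    n₁ + b₂ + i      ≡⟨ shift-+ i ⟩
    n₂ + b₁ + i + t  ≡⟨ cong (_+ t) (xy∙z≈xz∙y n₂ b₁ i) ⟩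
    n₂ + i + b₁ + t  ∎

  shift-+n₁b₁ : ∀ i → n₁ + i + b₂ ≡ n₂ + (b₁ + i) + t
  shift-+n₁b₁ i = begin
    n₁ + i + b₂        ≡⟨ xy∙z≈xz∙y n₁ i b₂ ⟩
    n₁ + b₂ + i        ≡⟨ shift-+ i ⟩
    n₂ + b₁ + i + t    ≡⟨ cong (_+ t) (+-assoc n₂ b₁ i) ⟩
    n₂ + (b₁ + i) + t  ∎

  shift-+b : ∀ j → n₁ + (b₂ + j) ≡ n₂ + (b₁ + j) + t
  shift-+b j = begin
    n₁ + (b₂ + j)      ≡⟨ sym (+-assoc n₁ b₂ j) ⟩
    n₁ + b₂ + j        ≡⟨ shift-+ j ⟩
    n₂ + b₁ + j + t    ≡⟨ cong (_+ t) (+-assoc n₂ b₁ j) ⟩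
    n₂ + (b₁ + j) + t  ∎

m+n≢o+[n+1] : ∀ {m n o} → m ≤ o → m + n ≢ o + (n + 1)
m+n≢o+[n+1] {m} {n} {o} m≤o eq = <-irrefl eq (begin-strict
  m + n        ≤⟨ +-monoˡ-≤ n m≤o ⟩
  o + n        <⟨ +-monoʳ-< o (n<1+n n) ⟩
  o + suc n    ≡⟨ cong (o +_) (+-comm 1 n) ⟩
  o + (n + 1)  ∎)
  where open ≤-Reasoning

sum-mono-≤ : ∀ {n} {f g : Fin n → ℕ} → (∀ i → f i ≤ g i) → sum f ≤ sum g
sum-mono-≤ {zero}  f≤g = z≤n
sum-mono-≤ {suc n} f≤g = +-mono-≤ (f≤g fzero) (sum-mono-≤ (f≤g ∘ fsuc))

sum-update : ∀ {n} (f g : Fin n → ℕ) i d → f i ≡ g i + d → (∀ j → j ≢ i → f j ≡ g j) →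
             sum f ≡ sum g + d
sum-update {suc n} f g fzero    d fi gj =
  trans (cong₂ _+_ fi (sum-cong-≗ (λ j → gj (fsuc j) λ ()))) (xy∙z≈xz∙y (g fzero) d _)
sum-update {suc n} f g (fsuc i) d fi gj =
  trans (cong₂ _+_ (gj fzero λ ()) (sum-update (λ j → f (fsuc j)) (λ j → g (fsuc j)) i d fi
                                      (λ j j≢i → gj (fsuc j) (j≢i ∘ fsuc-injective))))
        (sym (+-assoc (g fzero) _ d))

sum-allFin : ∀ {n} (f : Fin n → ℕ) → sumˡ (map f (allFin n)) ≡ sum f
sum-allFin f = trans (cong sumˡ (map-tabulate id f)) (sum-tabulate f)
  where
  sum-tabulate : ∀ {n} (f : Fin n → ℕ) → sumˡ (List.tabulate f) ≡ sum f
  sum-tabulate {zero}  f = refl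
  sum-tabulate {suc n} f = cong (f fzero +_) (sum-tabulate (f ∘ fsuc))

sum-ones : ∀ n → sum {n} (λ _ → 1) ≡ n
sum-ones zero    = refl
sum-ones (suc n) = cong suc (sum-ones n)

𝟙[_∈_] : ∀ {n} → Fin n → Subset n → ℕ
𝟙[ i ∈ p ] = if does (i ∈? p) then 1 else 0

∣p∣≡∑𝟙 : ∀ {n} (p : Subset n) → ∣ p ∣ ≡ sum λ i → 𝟙[ i ∈ p ]
∣p∣≡∑𝟙 []          = refl
∣p∣≡∑𝟙 (true ∷ p)  = cong suc (∣p∣≡∑𝟙 p)
∣p∣≡∑𝟙 (false ∷ p) = ∣p∣≡∑𝟙 p

∈?-∁ : ∀ {n} (p : Subset n) i → does (i ∈? ∁ p) ≡ not (does (i ∈? p))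
∈?-∁ (true ∷ p)  fzero    = refl
∈?-∁ (false ∷ p) fzero    = refl
∈?-∁ (_ ∷ p)     (fsuc i) = ∈?-∁ p i

𝟙≤1 : ∀ {n} (p : Subset n) i → 𝟙[ i ∈ p ] ≤ 1
𝟙≤1 p i with does (i ∈? p)
... | true  = ≤-refl
... | false = z≤n

𝟙-∁ : ∀ {n} (p : Subset n) i → 𝟙[ i ∈ ∁ p ] ≡ δ 0 𝟙[ i ∈ p ]
𝟙-∁ p i rewrite ∈?-∁ p i with does (i ∈? p)
... | true  = refl
... | false = refl

∈?-tabulate : ∀ {n} (f : Fin n → Bool) i → does (i ∈? tabulate f) ≡ f i
∈?-tabulate f fzero with f fzero
... | true  = refl
... | false = refl
∈?-tabulate f (fsuc i) = ∈?-tabulate (f ∘ fsuc) i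

module Multiplicity {A : Set} (_≟_ : DecidableEquality A) where

  infixl 6 _⊕_

  _⊕_ : (A → ℕ) → A → A → ℕ
  (κ ⊕ c) d = if does (c ≟ d) then suc (κ d) else κ d

  ⊕-self : ∀ κ c → (κ ⊕ c) c ≡ suc (κ c)
  ⊕-self κ c with c ≟ c
  ... | yes _   = refl
  ... | no c≢c = ⊥-elim (c≢c refl)

  ⊕-other : ∀ κ {c d} → c ≢ d → (κ ⊕ c) d ≡ κ d
  ⊕-other κ {c} {d} c≢d with c ≟ d
  ... | yes c≡d = ⊥-elim (c≢d c≡d)
  ... | no _    = refl

  ⊕-cancel : ∀ κ κ′ c d → (κ ⊕ c) d ≡ (κ′ ⊕ c) d → κ d ≡ κ′ d
  ⊕-cancel κ κ′ c d e with c ≟ d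
  ... | yes _ = suc-injective e
  ... | no _  = e

  count : List A → A → ℕ
  count []      = λ _ → 0
  count (c ∷ l) = count l ⊕ c

  count-∉ : ∀ l {c} → c ∉ l → count l c ≡ 0
  count-∉ []      _   = refl
  count-∉ (d ∷ l) c∉ =
    trans (⊕-other (count l) (λ d≡c → c∉ (here (sym d≡c)))) (count-∉ l (c∉ ∘ there))

  count-unique : ∀ {l c} → Unique l → c ∈ l → count l c ≡ 1
  count-unique {d ∷ l} (d∉l ∷ u) (here refl) =
    trans (⊕-self (count l) d) (cong suc (count-∉ l (All¬⇒¬Any d∉l)))
  count-unique {d ∷ l} {c} (d∉l ∷ u) (there c∈l) =
    trans (⊕-other (count l) d≢c) (count-unique u c∈l)
    where
    d≢c : d ≢ c
    d≢c refl = All.lookup d∉l c∈l refl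

  count-++ : ∀ l m d → count (l ++ m) d ≡ count l d + count m d
  count-++ []      m d = refl
  count-++ (c ∷ l) m d with c ≟ d
  ... | yes _ = cong suc (count-++ l m d)
  ... | no _  = count-++ l m d

  count-∈ : ∀ l {c k} → count l c ≡ suc k → c ∈ l
  count-∈ (d ∷ l) {c} e with d ≟ c
  ... | yes d≡c = here (sym d≡c)
  ... | no _    = there (count-∈ l e)

  count-↭ : ∀ {l m} → l ↭ m → ∀ d → count l d ≡ count m d
  count-↭ ↭.refl         d = refl
  count-↭ (↭.prep c p)   d with c ≟ d
  ... | yes _ = cong suc (count-↭ p d)
  ... | no _  = count-↭ p d
  count-↭ (↭.swap b c p) d with b ≟ d | c ≟ d
  ... | yes _ | yes _ = cong (suc ∘ suc) (count-↭ p d)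
  ... | yes _ | no _  = cong suc (count-↭ p d)
  ... | no _  | yes _ = cong suc (count-↭ p d)
  ... | no _  | no _  = count-↭ p d
  count-↭ (↭.trans p q)  d = trans (count-↭ p d) (count-↭ q d)

  ↭-count : ∀ l m → (∀ d → count l d ≡ count m d) → l ↭ m
  ↭-count []      []      _ = ↭.refl
  ↭-count []      (c ∷ m) e = ⊥-elim (0≢1+n (trans (e c) (⊕-self (count m) c)))
  ↭-count (c ∷ l) m       e
    with m₁ , m₂ , refl ← ∈-∃++ (count-∈ m (trans (sym (e c)) (⊕-self (count l) c))) =
    ↭.trans (↭.prep c (↭-count l (m₁ ++ m₂) same-rest)) (↭-sym (shift c m₁ m₂))
    where
    same-rest : ∀ d → count l d ≡ count (m₁ ++ m₂) d
    same-rest d = ⊕-cancel (count l) (count (m₁ ++ m₂)) c d (trans (e d) (count-↭ (shift c m₁ m₂) d))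

-- Shuffle words and covering steps

module _ (M N : ℕ) where

  private
    L = Letter M N
    W = Word M N

  open Multiplicity (_≟L_ {M} {N})
  open import Data.List.Membership.DecPropositional (_≟L_ {M} {N}) using () renaming (_∈?_ to _∈L?_)

  xLetters : W → List (Fin N)
  xLetters = mapMaybe isX

  aLetters : W → List (Fin M)
  aLetters = mapMaybe isA

  Used : Set
  Used = List (Fin N)

  used : Used → Fin N → Bool
  used U y = does (memN y U)

  used-self : ∀ U y → used (y ∷ U) y ≡ true
  used-self U y with y ≟ᶠ y
  ... | yes _   = refl
  ... | no y≢y = ⊥-elim (y≢y refl)

  used-other : ∀ U {y z} → y ≢ z → used (y ∷ U) z ≡ used U z
  used-other U {y} {z} y≢z with z ≟ᶠ y
  ... | yes z≡y = ⊥-elim (y≢z (sym z≡y))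
  ... | no _    = refl

  freeAfter : Used → Maybe L → Bool
  freeAfter U (just (inj₂ y)) = not (used U y)
  freeAfter U _               = false

  lastFrom : Maybe L → W → Maybe L
  lastFrom p []      = p
  lastFrom p (c ∷ u) = lastFrom (just c) u

  lastFrom-snoc : ∀ p u (d : L) → lastFrom p (u ++ d ∷ []) ≡ just d
  lastFrom-snoc p []      d = refl
  lastFrom-snoc p (c ∷ u) d = lastFrom-snoc (just c) u d

  lastFrom-snoc⁻ : ∀ (c : L) u {d} → lastFrom (just c) u ≡ just d → ∃ λ u′ → c ∷ u ≡ u′ ++ d ∷ []
  lastFrom-snoc⁻ c []      refl = [] , refl
  lastFrom-snoc⁻ c (e ∷ u) eq with u′ , eq′ ← lastFrom-snoc⁻ e u eq = c ∷ u′ , cong (c ∷_) eq′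

  data Step (U : Used) (w w′ : W) : L → Used → Set where
    delete-a       : ∀ u v a → w ≡ u ++ inj₁ a ∷ v → w′ ≡ u ++ v →
                     freeAfter U (lastFrom nothing u) ≡ false → Step U w w′ (inj₁ a) U
    delete-after-x : ∀ u v y a → w ≡ u ++ inj₂ y ∷ inj₁ a ∷ v → w′ ≡ u ++ inj₂ y ∷ v →
                     used U y ≡ false → Step U w w′ (inj₂ y) (y ∷ U)
    insert-x       : ∀ u v x → w ≡ u ++ v → w′ ≡ u ++ inj₂ x ∷ v → Step U w w′ (inj₂ x) U

  private
    snoc-assoc : ∀ (u : W) c d v → (u ++ c ∷ []) ++ d ∷ v ≡ u ++ c ∷ d ∷ v
    snoc-assoc u c d v = ++-assoc u (c ∷ []) (d ∷ v)

  cover⇒step : ∀ U {w w′} → w ⋖ w′ → ∃₂ λ c U′ → Step U w w′ c U′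
  cover⇒step U (_ , _ , inj₂ (u , v , x , w≡ , w′≡)) = _ , _ , insert-x u v x w≡ w′≡
  cover⇒step U (_ , _ , inj₁ (u , v , a , w≡ , w′≡)) with lastFrom nothing u in last≡
  ... | nothing         = _ , _ , delete-a u v a w≡ w′≡ (cong (freeAfter U) last≡)
  ... | just (inj₁ _)   = _ , _ , delete-a u v a w≡ w′≡ (cong (freeAfter U) last≡)
  ... | just (inj₂ y) with used U y in used≡
  ...   | true = _ , _ , delete-a u v a w≡ w′≡ (trans (cong (freeAfter U) last≡) (cong not used≡))
  cover⇒step U (_ , _ , inj₁ (c ∷ u , v , a , w≡ , w′≡)) | just (inj₂ y) | false
    with u′ , u≡ ← lastFrom-snoc⁻ c u last≡ =
    _ , _ , delete-after-x u′ v y a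
              (trans w≡ (trans (cong (_++ inj₁ a ∷ v) u≡) (snoc-assoc u′ (inj₂ y) (inj₁ a) v)))
              (trans w′≡ (trans (cong (_++ v) u≡) (++-assoc u′ (inj₂ y ∷ []) v))) used≡

  step⇒cover : ∀ {U w w′ c U′} → Step U w w′ c U′ → IsShuffle w → IsShuffle w′ → w ⋖ w′
  step⇒cover (delete-a u v a w≡ w′≡ _)         sw sw′ = sw , sw′ , inj₁ (u , v , a , w≡ , w′≡)
  step⇒cover (delete-after-x u v y a w≡ w′≡ _) sw sw′ =
    sw , sw′ , inj₁ (u ++ inj₂ y ∷ [] , v , a , trans w≡ (sym (snoc-assoc u (inj₂ y) (inj₁ a) v)) ,
                                                trans w′≡ (sym (++-assoc u (inj₂ y ∷ []) v)))
  step⇒cover (insert-x u v x w≡ w′≡)          sw sw′ = sw , sw′ , inj₂ (u , v , x , w≡ , w′≡)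

  private
    change-same : ∀ p (c : L) w w′ → change p (c ∷ w) (c ∷ w′) ≡ change (just c) w w′
    change-same p c w w′ with c ≟L c
    ... | yes _   = refl
    ... | no c≢c = ⊥-elim (c≢c refl)

  change-delete : ∀ p u (c : L) v → c ∉ v → change p (u ++ c ∷ v) (u ++ v) ≡ del c (lastFrom p u)
  change-delete p []      c []      _   = refl
  change-delete p []      c (d ∷ v) c∉v with c ≟L d
  ... | yes c≡d = ⊥-elim (c∉v (here c≡d))
  ... | no _ with length v <ᵇ suc (length v) | <⇒<ᵇ (n<1+n (length v))
  ...   | true | _ = refl
  change-delete p (d ∷ u) c v c∉v = trans (change-same p d _ _) (change-delete (just d) u c v c∉v)

  change-insert : ∀ p u (c : L) v → c ∉ v → change p (u ++ v) (u ++ c ∷ v) ≡ ins c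
  change-insert p []      c []      _   = refl
  change-insert p []      c (d ∷ v) c∉v with d ≟L c
  ... | yes d≡c = ⊥-elim (c∉v (here (sym d≡c)))
  ... | no _ with suc (length v) <ᵇ length v | <ᵇ⇒< (suc (length v)) (length v)
  ...   | false | _ = refl
  ...   | true  | sv<v = ⊥-elim (n≮n (length v) (<-trans (n<1+n (length v)) (sv<v tt)))
  change-insert p (d ∷ u) c v c∉v = trans (change-same p d _ _) (change-insert (just d) u c v c∉v)

  label-delete-a : ∀ U (a : Fin M) p → freeAfter U p ≡ false →
                   stepLabel U (del (inj₁ a) p) ≡ (just (inj₁ a) , U)
  label-delete-a U a nothing         _ = refl
  label-delete-a U a (just (inj₁ _)) _ = refl
  label-delete-a U a (just (inj₂ y)) not-free with memN y U
  ... | yes _ = refl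

  label-delete-after-x : ∀ U (a : Fin M) y → used U y ≡ false →
                         stepLabel U (del (inj₁ a) (just (inj₂ y))) ≡ (just (inj₂ y) , y ∷ U)
  label-delete-after-x U a y unused with memN y U
  ... | no _ = refl

  step-label : ∀ {U w w′ c U′} → Step U w w′ c U′ → IsShuffle w → IsShuffle w′ →
               stepLabel U (change nothing w w′) ≡ (just c , U′)
  step-label {U} (delete-a u v a refl refl not-free) (uniq , _) _ =
    trans (cong (stepLabel U) (change-delete nothing u (inj₁ a) v (Unique-∉ʳ u uniq)))
          (label-delete-a U a (lastFrom nothing u) not-free)
  step-label {U} (delete-after-x u v y a refl refl unused) (uniq , _) _ = begin
    stepLabel U (change nothing (u ++ inj₂ y ∷ inj₁ a ∷ v) (u ++ inj₂ y ∷ v))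
      ≡⟨ cong₂ (λ (w w′ : W) → stepLabel U (change nothing w w′))
               (sym (snoc-assoc u (inj₂ y) (inj₁ a) v)) (sym (++-assoc u (inj₂ y ∷ []) v)) ⟩
    stepLabel U (change nothing (u′ ++ inj₁ a ∷ v) (u′ ++ v))
      ≡⟨ cong (stepLabel U) (change-delete nothing u′ (inj₁ a) v
                               (Unique-∉ʳ u′ (subst Unique (sym (snoc-assoc u (inj₂ y) (inj₁ a) v)) uniq))) ⟩
    stepLabel U (del (inj₁ a) (lastFrom nothing u′))
      ≡⟨ cong (stepLabel U ∘ del (inj₁ a)) (lastFrom-snoc nothing u (inj₂ y)) ⟩
    stepLabel U (del (inj₁ a) (just (inj₂ y)))
      ≡⟨ label-delete-after-x U a y unused ⟩
    (just (inj₂ y) , y ∷ U) ∎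
    where
    open ≡-Reasoning
    u′ = u ++ inj₂ y ∷ []
  step-label {U} (insert-x u v x refl refl) _ (uniq′ , _) =
    cong (stepLabel U) (change-insert nothing u (inj₂ x) v (Unique-∉ʳ u uniq′))

  labelsFrom-step : ∀ {U w w′ c U′} ws → Step U w w′ c U′ → IsShuffle w → IsShuffle w′ →
                    labelsFrom U w (w′ ∷ ws) ≡ c ∷ labelsFrom U′ w′ ws
  labelsFrom-step ws st sw sw′ rewrite step-label st sw sw′ = refl

  xLetters-++ : ∀ u v → xLetters (u ++ v) ≡ xLetters u ++ xLetters v
  xLetters-++ = mapMaybe-++ isX

  aLetters-++ : ∀ u v → aLetters (u ++ v) ≡ aLetters u ++ aLetters v
  aLetters-++ = mapMaybe-++ isA

  private
    Sorted : ∀ {n} → List (Fin n) → Set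
    Sorted = Linked _<ᶠ_

  shuffle-delete-a : ∀ u {a v} → IsShuffle (u ++ inj₁ a ∷ v) → IsShuffle (u ++ v)
  shuffle-delete-a u {a} {v} (uniq , sa , sx) =
    Unique-delete u uniq ,
    subst Sorted (sym (aLetters-++ u v))
      (Linked-delete <ᶠ-trans (aLetters u) (subst Sorted (aLetters-++ u (inj₁ a ∷ v)) sa)) ,
    subst Sorted (sym (xLetters-++ u v)) (subst Sorted (xLetters-++ u (inj₁ a ∷ v)) sx)

  shuffle-delete-after-x : ∀ u {y a v} → IsShuffle (u ++ inj₂ y ∷ inj₁ a ∷ v) → IsShuffle (u ++ inj₂ y ∷ v)
  shuffle-delete-after-x u {y} {a} {v} sw =
    subst IsShuffle (++-assoc u (inj₂ y ∷ []) v)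
      (shuffle-delete-a (u ++ inj₂ y ∷ []) (subst IsShuffle (sym (snoc-assoc u (inj₂ y) (inj₁ a) v)) sw))

  shuffle-insert-x : ∀ u {x v} → IsShuffle (u ++ v) → inj₂ x ∉ u ++ v →
                     All (_<ᶠ x) (xLetters u) → All (x <ᶠ_) (xLetters v) → IsShuffle (u ++ inj₂ x ∷ v)
  shuffle-insert-x u {x} {v} (uniq , sa , sx) x∉ below above =
    Unique-insert u uniq x∉ ,
    subst Sorted (sym (aLetters-++ u (inj₂ x ∷ v))) (subst Sorted (aLetters-++ u v) sa) ,
    subst Sorted (sym (xLetters-++ u (inj₂ x ∷ v)))
      (Linked-insert (xLetters u) (subst Sorted (xLetters-++ u v) sx) below above)

  shuffle-split-x : ∀ u {x v} → IsShuffle (u ++ inj₂ x ∷ v) →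
                    All (_<ᶠ x) (xLetters u) × All (x <ᶠ_) (xLetters v)
  shuffle-split-x u {x} {v} (_ , _ , sx) =
    Linked-split <ᶠ-trans (xLetters u) (subst Sorted (xLetters-++ u (inj₂ x ∷ v)) sx)

  Consistent : Used → W → Set
  Consistent U w = IsShuffle w × (∀ y → used U y ≡ true → inj₂ y ∈ w)

  unused-if-absent : ∀ {U w y} → Consistent U w → inj₂ y ∉ w → used U y ≡ false
  unused-if-absent {U} {y = y} (_ , used⊆w) y∉w with used U y in eq
  ... | true  = ⊥-elim (y∉w (used⊆w y eq))
  ... | false = refl

  step-consistent : ∀ {U w w′ c U′} → Step U w w′ c U′ → Consistent U w → IsShuffle w′ →
                    Consistent U′ w′
  step-consistent (delete-a u v a refl refl _) (_ , used⊆w) sw′ =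
    sw′ , λ y y-used → ∈-delete u (used⊆w y y-used) λ ()
  step-consistent {U} (delete-after-x u v y a refl refl _) (_ , used⊆w) sw′ = sw′ , used⊆w′
    where
    used⊆w′ : ∀ z → used (y ∷ U) z ≡ true → inj₂ z ∈ u ++ inj₂ y ∷ v
    used⊆w′ z z-used with y ≟ᶠ z
    ... | yes refl = ∈-insert u
    ... | no y≢z   = subst (inj₂ z ∈_) (++-assoc u (inj₂ y ∷ []) v)
                       (∈-delete (u ++ inj₂ y ∷ [])
                         (subst (inj₂ z ∈_) (sym (snoc-assoc u (inj₂ y) (inj₁ a) v))
                           (used⊆w z (trans (sym (used-other U y≢z)) z-used)))
                         λ ())
  step-consistent (insert-x u v x refl refl) (_ , used⊆w) sw′ =
    sw′ , λ y y-used → ∈-insert⁺ u (used⊆w y y-used)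

  consistent-bot : Consistent [] (bot M N)
  consistent-bot =
    (Unique.map⁺ inj₁-injective (Unique.allFin⁺ M) ,
     subst Sorted (sym (mapMaybe-map-retract (λ _ → refl) (allFin M))) (allFin-sorted M) ,
     subst Sorted (sym (xLetters-bot (allFin M))) []) ,
    λ y ()
    where
    xLetters-bot : ∀ (l : List (Fin M)) → xLetters (map inj₁ l) ≡ []
    xLetters-bot []      = refl
    xLetters-bot (_ ∷ l) = xLetters-bot l

  -- Feasible label budgets

  Budget : Set
  Budget = L → ℕ

  doubled : Budget → Fin N → ℕ
  doubled κ y = δ 2 (κ (inj₂ y))

  doubles : Budget → ℕ
  doubles κ = sum (doubled κ)

  doublesBelow : Budget → Fin N → ℕ
  doublesBelow κ y = sum λ z → when (z <ᶠ? y) (doubled κ z)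

  doublesBelow-mono : ∀ κ {y z} → y ≤ᶠ z → doublesBelow κ y ≤ doublesBelow κ z
  doublesBelow-mono κ {y} {z} y≤z = sum-mono-≤ below
    where
    below : ∀ i → when (i <ᶠ? y) (doubled κ i) ≤ when (i <ᶠ? z) (doubled κ i)
    below i with i <ᶠ? y | i <ᶠ? z
    ... | yes _   | yes _   = ≤-refl
    ... | yes i<y | no i≮z = ⊥-elim (i≮z (<-≤-trans i<y y≤z))
    ... | no _    | _       = z≤n

  doublesBelow≤doubles : ∀ κ y → doublesBelow κ y ≤ doubles κ
  doublesBelow≤doubles κ y = sum-mono-≤ below
    where
    below : ∀ i → when (i <ᶠ? y) (doubled κ i) ≤ doubled κ i
    below i with i <ᶠ? y
    ... | yes _ = ≤-refl
    ... | no _  = z≤n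

  private
    δ2-suc : ∀ {k} → k ≤ 1 → δ 2 (suc k) ≡ δ 2 k + δ 1 k
    δ2-suc {zero}  _ = refl
    δ2-suc {suc zero} _ = refl
    δ2-suc {suc (suc _)} (s≤s ())

    doubled-⊕-self : ∀ κ x → κ (inj₂ x) ≤ 1 →
                     doubled (κ ⊕ inj₂ x) x ≡ doubled κ x + δ 1 (κ (inj₂ x))
    doubled-⊕-self κ x κx≤1 = trans (cong (δ 2) (⊕-self κ (inj₂ x))) (δ2-suc κx≤1)

  doubles-⊕ : ∀ κ x → κ (inj₂ x) ≤ 1 → doubles (κ ⊕ inj₂ x) ≡ doubles κ + δ 1 (κ (inj₂ x))
  doubles-⊕ κ x κx≤1 = sum-update _ _ x _ (doubled-⊕-self κ x κx≤1)
                    λ z z≢x → cong (δ 2) (⊕-other κ (z≢x ∘ sym ∘ inj₂-injective))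

  doublesBelow-⊕ : ∀ κ x y → κ (inj₂ x) ≤ 1 → doublesBelow (κ ⊕ inj₂ x) y ≡
                   doublesBelow κ y + when (x <ᶠ? y) (δ 1 (κ (inj₂ x)))
  doublesBelow-⊕ κ x y κx≤1 = sum-update _ _ x _ at-x
                           λ z z≢x → cong (λ k → when (z <ᶠ? y) (δ 2 k))
                                          (⊕-other κ (z≢x ∘ sym ∘ inj₂-injective))
    where
    at-x : when (x <ᶠ? y) (doubled (κ ⊕ inj₂ x) x) ≡
           when (x <ᶠ? y) (doubled κ x) + when (x <ᶠ? y) (δ 1 (κ (inj₂ x)))
    at-x with x <ᶠ? y
    ... | yes _ = doubled-⊕-self κ x κx≤1
    ... | no _  = refl

  -- A word is read from left to right. absorbed counts the a-letters that an (xa) step will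
  -- delete, pending the present unused x-letters that will still perform an (xa) step, and free
  -- tells whether the last letter read is an unused x-letter, whose next deletion is (xa). At an
  -- x-letter y the absorbed a-letters must be exactly those matched with x-letters before y:
  -- the pending ones, and the absent z < y with two labels left, which get inserted before y.
  record Tally : Set where
    constructor tally
    field
      absorbed : ℕ
      pending  : ℕ
      free     : Bool

  open Tally

  start : Tally
  start = tally 0 0 false

  module Scan (κ : Budget) (U : Used) where

    pendingAt : Fin N → ℕ
    pendingAt y = if (κ (inj₂ y) ≡ᵇ 1) ∧ not (used U y) then 1 else 0

    next : Tally → L → Tally
    next (tally n b _) (inj₁ a) = tally (n + δ 0 (κ (inj₁ a))) b false
    next (tally n b _) (inj₂ y) = tally n (b + pendingAt y) (not (used U y))

    Admissible : Tally → L → Set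
    Admissible s             (inj₁ a) = free s ≡ true → κ (inj₁ a) ≡ 0
    Admissible (tally n b _) (inj₂ y) = n ≡ doublesBelow κ y + b

    Closed : Tally → Set
    Closed (tally n b _) = n ≡ doubles κ + b

    Run : Tally → W → Set
    Run s []      = ⊤
    Run s (c ∷ w) = Admissible s c × Run (next s c) w

    BalancedFrom : Tally → W → Set
    BalancedFrom s []      = Closed s
    BalancedFrom s (c ∷ w) = Admissible s c × BalancedFrom (next s c) w

    after : Tally → W → Tally
    after = foldl next

    Balanced : W → Set
    Balanced = BalancedFrom start

    balancedFrom-++ : ∀ u {v} s → BalancedFrom s (u ++ v) ⇔ (Run s u × BalancedFrom (after s u) v)
    balancedFrom-++ []      s = mk⇔ (tt ,_) proj₂
    balancedFrom-++ (c ∷ u) s = mk⇔ (λ (adm , bf) → let r , bf′ = to bf in (adm , r) , bf′)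
                                    (λ ((adm , r) , bf′) → adm , from (r , bf′))
      where open Equivalence (balancedFrom-++ u (next s c))

    after-free : ∀ u s p → free s ≡ freeAfter U p → free (after s u) ≡ freeAfter U (lastFrom p u)
    after-free []            s p eq = eq
    after-free (inj₁ a ∷ u) s p _  = after-free u _ (just (inj₁ a)) refl
    after-free (inj₂ y ∷ u) s p _  = after-free u _ (just (inj₂ y)) refl

    balancedFrom-unfree : ∀ v {n b h} → BalancedFrom (tally n b true) v → BalancedFrom (tally n b h) v
    balancedFrom-unfree []            bf              = bf
    balancedFrom-unfree (inj₁ a ∷ v) (adm , bf)      = (λ _ → adm refl) , bf
    balancedFrom-unfree (inj₂ y ∷ v) bf              = bf

  module Transport (κ₁ κ₂ : Budget) (U₁ U₂ : Used) where

    private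
      module S₁ = Scan κ₁ U₁
      module S₂ = Scan κ₂ U₂

    Agree : ℕ → L → Set
    Agree t (inj₁ a) = κ₁ (inj₁ a) ≡ κ₂ (inj₁ a)
    Agree t (inj₂ y) = κ₁ (inj₂ y) ≡ κ₂ (inj₂ y) × used U₁ y ≡ used U₂ y ×
                       doublesBelow κ₁ y ≡ doublesBelow κ₂ y + t

    Shifted : ℕ → Tally → Tally → Set
    Shifted t (tally n₁ b₁ h₁) (tally n₂ b₂ h₂) = h₁ ≡ h₂ × n₁ + b₂ ≡ n₂ + b₁ + t

    step-transport : ∀ {t} c {s₁ s₂} → Agree t c → Shifted t s₁ s₂ →
                     (S₁.Admissible s₁ c ⇔ S₂.Admissible s₂ c) × Shifted t (S₁.next s₁ c) (S₂.next s₂ c)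
    step-transport {t} (inj₁ a) {tally n₁ b₁ _} {tally n₂ b₂ _} κ≡ (refl , shift) rewrite κ≡ =
      mk⇔ id id , refl , shift-+n {t} {n₁} {b₁} {n₂} {b₂} shift (δ 0 (κ₂ (inj₁ a)))
    step-transport {t} (inj₂ y) {tally n₁ b₁ _} {tally n₂ b₂ _} (κ≡ , used≡ , below≡) (refl , shift)
      rewrite κ≡ | used≡ =
      shift-check shift below≡ , refl , shift-+b {t} {n₁} {b₁} {n₂} {b₂} shift (S₂.pendingAt y)

    run-transport : ∀ {t} u {s₁ s₂} → All (Agree t) u → Shifted t s₁ s₂ →
                    (S₁.Run s₁ u ⇔ S₂.Run s₂ u) × Shifted t (S₁.after s₁ u) (S₂.after s₂ u)
    run-transport []      []          sh = mk⇔ id id , sh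
    run-transport (c ∷ u) (ag ∷ ags) sh =
      let adm , sh′ = step-transport c ag sh
          run , sh″ = run-transport u ags sh′
      in (adm ×-⇔ run) , sh″

    balancedFrom-transport : ∀ {t} v {s₁ s₂} → All (Agree t) v → doubles κ₁ ≡ doubles κ₂ + t →
                             Shifted t s₁ s₂ → S₁.BalancedFrom s₁ v ⇔ S₂.BalancedFrom s₂ v
    balancedFrom-transport [] {tally _ _ _} {tally _ _ _} [] D≡ (_ , shift) = shift-check shift D≡
    balancedFrom-transport (c ∷ v) (ag ∷ ags) D≡ sh =
      let adm , sh′ = step-transport c ag sh
      in adm ×-⇔ balancedFrom-transport v ags D≡ sh′

  balanced-delete-a : ∀ κ U u v a → κ (inj₁ a) ≡ 0 → inj₁ a ∉ u ++ v →
                      freeAfter U (lastFrom nothing u) ≡ false →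
                      Scan.Balanced (κ ⊕ inj₁ a) U (u ++ inj₁ a ∷ v) ⇔ Scan.Balanced κ U (u ++ v)
  balanced-delete-a κ U u v a κa≡0 a∉ not-free =
    ⇔-trans (S₁.balancedFrom-++ u start) (⇔-trans (run ×-⇔ rest) (⇔-sym (S₂.balancedFrom-++ u start)))
    where
    open Transport (κ ⊕ inj₁ a) κ U U
    module S₁ = Scan (κ ⊕ inj₁ a) U
    module S₂ = Scan κ U
    agree-on : ∀ l → inj₁ a ∉ l → All (Agree 0) l
    agree-on l a∉l = All.tabulate agree
      where
      agree : ∀ {d} → d ∈ l → Agree 0 d
      agree {inj₁ b} b∈l = ⊕-other κ {inj₁ a} λ { refl → a∉l b∈l }
      agree {inj₂ y} _   = refl , refl , sym (+-identityʳ _)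
    s₁ = S₁.after start u
    s₂ = S₂.after start u
    transported = run-transport u (agree-on u (a∉ ∘ ∈-++⁺ˡ)) (refl , refl)
    run = proj₁ transported
    s₁-not-free : free s₁ ≡ false
    s₁-not-free = trans (S₁.after-free u start nothing refl) not-free
    s₂-not-free : free s₂ ≡ false
    s₂-not-free = trans (S₂.after-free u start nothing refl) not-free
    shifted : Shifted 0 (S₁.next s₁ (inj₁ a)) s₂
    shifted = sym s₂-not-free ,
              trans (cong (λ k → absorbed s₁ + δ 0 k + pending s₂)
                          (trans (⊕-self κ (inj₁ a)) (cong suc κa≡0)))
                    (trans (cong (_+ pending s₂) (+-identityʳ _)) (proj₂ (proj₂ transported)))
    rest : (S₁.Admissible s₁ (inj₁ a) × S₁.BalancedFrom (S₁.next s₁ (inj₁ a)) v) ⇔ S₂.BalancedFrom s₂ v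
    rest = mk⇔ (λ (_ , bf) → Equivalence.to bf⇔ bf)
               (λ bf → (λ s₁-free → ⊥-elim (false≢true (trans (sym s₁-not-free) s₁-free))) ,
                       Equivalence.from bf⇔ bf)
      where
      bf⇔ = balancedFrom-transport v (agree-on v (a∉ ∘ ∈-++⁺ʳ u)) (sym (+-identityʳ _)) shifted

  ∈-xLetters : ∀ l {z} → inj₂ z ∈ l → z ∈ xLetters l
  ∈-xLetters (inj₁ _ ∷ l) (there z∈l) = ∈-xLetters l z∈l
  ∈-xLetters (inj₂ _ ∷ l) (here refl) = here refl
  ∈-xLetters (inj₂ _ ∷ l) (there z∈l) = there (∈-xLetters l z∈l)

  agree-⊕x : ∀ κ U₁ U₂ x t l → κ (inj₂ x) ≤ 1 → inj₂ x ∉ l →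
             (∀ z → inj₂ z ∈ l → used U₁ z ≡ used U₂ z) →
             (∀ z → inj₂ z ∈ l → when (x <ᶠ? z) (δ 1 (κ (inj₂ x))) ≡ t) →
             All (Transport.Agree (κ ⊕ inj₂ x) κ U₁ U₂ t) l
  agree-⊕x κ U₁ U₂ x t l κx≤1 x∉l used≡ shift≡ = All.tabulate agree
    where
    agree : ∀ {d} → d ∈ l → Transport.Agree (κ ⊕ inj₂ x) κ U₁ U₂ t d
    agree {inj₁ a} _   = refl
    agree {inj₂ z} z∈l = ⊕-other κ {inj₂ x} (λ { refl → x∉l z∈l }) , used≡ z z∈l ,
                         trans (doublesBelow-⊕ κ x z κx≤1) (cong (doublesBelow κ z +_) (shift≡ z z∈l))

  balanced-delete-after-x : ∀ κ U u v y a → κ (inj₂ y) ≡ 0 → κ (inj₁ a) ≡ 0 → inj₂ y ∉ u ++ v →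
                            used U y ≡ false →
                            Scan.Balanced (κ ⊕ inj₂ y) U (u ++ inj₂ y ∷ inj₁ a ∷ v) ⇔
                            Scan.Balanced κ (y ∷ U) (u ++ inj₂ y ∷ v)
  balanced-delete-after-x κ U u v y a κy≡0 κa≡0 y∉ unused =
    ⇔-trans (S₁.balancedFrom-++ u start) (⇔-trans (run ×-⇔ rest) (⇔-sym (S₂.balancedFrom-++ u start)))
    where
    open Transport (κ ⊕ inj₂ y) κ U (y ∷ U)
    module S₁ = Scan (κ ⊕ inj₂ y) U
    module S₂ = Scan κ (y ∷ U)
    κy≤1 : κ (inj₂ y) ≤ 1
    κy≤1 = subst (_≤ 1) (sym κy≡0) z≤n
    no-shift : ∀ (z : Fin N) → when (y <ᶠ? z) (δ 1 (κ (inj₂ y))) ≡ 0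
    no-shift z = trans (cong (λ k → when (y <ᶠ? z) (δ 1 k)) κy≡0) (when-0 (y <ᶠ? z))
    agree-on : ∀ l → inj₂ y ∉ l → All (Agree 0) l
    agree-on l y∉l = agree-⊕x κ U (y ∷ U) y 0 l κy≤1 y∉l
                       (λ z z∈l → sym (used-other U λ { refl → y∉l z∈l })) (λ z _ → no-shift z)
    s₁ = S₁.after start u
    s₂ = S₂.after start u
    transported = run-transport u (agree-on u (y∉ ∘ ∈-++⁺ˡ)) (refl , refl)
    run = proj₁ transported
    shift₀ = proj₂ (proj₂ transported)
    pending₁ : S₁.pendingAt y ≡ 1
    pending₁ rewrite ⊕-self κ (inj₂ y) | κy≡0 | unused = refl
    pending₂ : S₂.pendingAt y ≡ 0
    pending₂ rewrite κy≡0 = refl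
    shifted : Shifted 0 (S₁.next (S₁.next s₁ (inj₂ y)) (inj₁ a)) (S₂.next s₂ (inj₂ y))
    shifted = cong not (sym (used-self U y)) , (begin
      n₁ + δ 0 (κ (inj₁ a)) + (b₂ + S₂.pendingAt y)
        ≡⟨ cong₂ (λ i j → n₁ + i + (b₂ + j)) (cong (δ 0) κa≡0) pending₂ ⟩
      n₁ + 1 + (b₂ + 0)                             ≡⟨ cong (n₁ + 1 +_) (+-identityʳ b₂) ⟩
      n₁ + 1 + b₂                                   ≡⟨ shift-+n₁b₁ {0} {n₁} {b₁} {n₂} {b₂} shift₀ 1 ⟩
      n₂ + (b₁ + 1) + 0                             ≡⟨ cong (λ j → n₂ + (b₁ + j) + 0) (sym pending₁) ⟩
      n₂ + (b₁ + S₁.pendingAt y) + 0                ∎)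
      where
      open ≡-Reasoning
      n₁ = absorbed s₁
      b₁ = pending s₁
      n₂ = absorbed s₂
      b₂ = pending s₂
    rest : S₁.BalancedFrom s₁ (inj₂ y ∷ inj₁ a ∷ v) ⇔ S₂.BalancedFrom s₂ (inj₂ y ∷ v)
    rest = shift-check shift₀ (trans (doublesBelow-⊕ κ y y κy≤1) (cong (doublesBelow κ y +_) (no-shift y))) ×-⇔
           mk⇔ (λ (_ , bf) → Equivalence.to bf⇔ bf) (λ bf → (λ _ → κa≡0) , Equivalence.from bf⇔ bf)
      where
      bf⇔ = balancedFrom-transport v (agree-on v (y∉ ∘ ∈-++⁺ʳ u))
              (trans (doubles-⊕ κ y κy≤1) (cong (doubles κ +_) (cong (δ 1) κy≡0))) shifted

  balanced-insert-x : ∀ κ U u v x → κ (inj₂ x) ≤ 1 → used U x ≡ false →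
                      All (_<ᶠ x) (xLetters u) → All (x <ᶠ_) (xLetters v) → inj₂ x ∉ u ++ v →
                      Scan.Balanced κ U (u ++ inj₂ x ∷ v) → Scan.Balanced (κ ⊕ inj₂ x) U (u ++ v)
  balanced-insert-x κ U u v x κx≤1 unused below above x∉ bal =
    Equivalence.from (S₁.balancedFrom-++ u start) (Equivalence.from run run₂ , Equivalence.from bf⇔ bf₂′)
    where
    open Transport (κ ⊕ inj₂ x) κ U U
    module S₁ = Scan (κ ⊕ inj₂ x) U
    module S₂ = Scan κ U
    t = δ 1 (κ (inj₂ x))
    s₁ = S₁.after start u
    s₂ = S₂.after start u
    transported = run-transport u
      (agree-⊕x κ U U x 0 u κx≤1 (x∉ ∘ ∈-++⁺ˡ) (λ _ _ → refl)
                λ z z∈u → when-no (x <ᶠ? z) (<ᶠ-asym (All.lookup below (∈-xLetters u z∈u))))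
      (refl , refl)
    run = proj₁ transported
    split₂ = Equivalence.to (S₂.balancedFrom-++ u start) bal
    run₂ = proj₁ split₂
    bf₂ = proj₂ (proj₂ split₂)
    pendingₓ : S₂.pendingAt x ≡ t
    pendingₓ rewrite unused | ∧-identityʳ (κ (inj₂ x) ≡ᵇ 1) = refl
    s₂′ = tally (absorbed s₂) (pending s₂ + t) (free s₁)
    bf₂′ : S₂.BalancedFrom s₂′ v
    bf₂′ = S₂.balancedFrom-unfree v
             (subst₂ (λ p h → S₂.BalancedFrom (tally (absorbed s₂) (pending s₂ + p) h) v)
                     pendingₓ (cong not unused) bf₂)
    shifted : Shifted t s₁ s₂′
    shifted = refl , (begin
      absorbed s₁ + (pending s₂ + t)  ≡⟨ sym (+-assoc (absorbed s₁) _ t) ⟩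
      absorbed s₁ + pending s₂ + t    ≡⟨ cong (_+ t) (trans (proj₂ (proj₂ transported)) (+-identityʳ _)) ⟩
      absorbed s₂ + pending s₁ + t    ∎)
      where open ≡-Reasoning
    bf⇔ = balancedFrom-transport v
      (agree-⊕x κ U U x t v κx≤1 (x∉ ∘ ∈-++⁺ʳ u) (λ _ _ → refl)
                λ z z∈v → when-yes (x <ᶠ? z) (All.lookup above (∈-xLetters v z∈v)))
      (doubles-⊕ κ x κx≤1) shifted

  balanced-not-free-before-a : ∀ κ U u v a → Scan.Balanced (κ ⊕ inj₁ a) U (u ++ inj₁ a ∷ v) →
                               freeAfter U (lastFrom nothing u) ≡ false
  balanced-not-free-before-a κ U u v a bal =
    trans (sym (S.after-free u start nothing refl)) (¬-not λ free≡true →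
      0≢1+n (trans (sym (adm free≡true)) (⊕-self κ (inj₁ a))))
    where
    module S = Scan (κ ⊕ inj₁ a) U
    adm = proj₁ (proj₂ (Equivalence.to (S.balancedFrom-++ u start) bal))

  balanced-after-x-is-a : ∀ κ U u r y → κ (inj₂ y) ≡ 0 → used U y ≡ false → All (y <ᶠ_) (xLetters r) →
                            Scan.Balanced (κ ⊕ inj₂ y) U (u ++ inj₂ y ∷ r) →
                            ∃₂ λ a v → r ≡ inj₁ a ∷ v × κ (inj₁ a) ≡ 0
  balanced-after-x-is-a κ U u r y κy≡0 unused above bal = next-is-a r above after-y
    where
    module S = Scan (κ ⊕ inj₂ y) U
    s = S.after start u
    at-y = proj₂ (Equivalence.to (S.balancedFrom-++ u start) bal)
    pending-y : S.pendingAt y ≡ 1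
    pending-y rewrite ⊕-self κ (inj₂ y) | κy≡0 | unused = refl
    after-y : S.BalancedFrom (tally (absorbed s) (pending s + 1) true) r
    after-y = subst₂ (λ p h → S.BalancedFrom (tally (absorbed s) (pending s + p) h) r)
                     pending-y (cong not unused) (proj₂ at-y)
    next-is-a : ∀ r → All (y <ᶠ_) (xLetters r) → S.BalancedFrom (tally (absorbed s) (pending s + 1) true) r →
                  ∃₂ λ a v → r ≡ inj₁ a ∷ v × κ (inj₁ a) ≡ 0
    next-is-a []            _           closed  =
      ⊥-elim (m+n≢o+[n+1] (doublesBelow≤doubles (κ ⊕ inj₂ y) y) (trans (sym (proj₁ at-y)) closed))
    next-is-a (inj₁ a ∷ v) _           (adm , _) = a , v , refl , adm refl
    next-is-a (inj₂ z ∷ _) (y<z ∷ _)  (adm , _) =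
      ⊥-elim (m+n≢o+[n+1] (doublesBelow-mono (κ ⊕ inj₂ y) (<⇒≤ y<z)) (trans (sym (proj₁ at-y)) adm))

  -- An inserted x-letter must sit where the balance check at x holds, and an a-letter right
  -- after it is deleted by its (xa) step, hence must be absorbed; this fixes the position.
  module Insertion (κ : Budget) (U : Used) (x : Fin N)
                   (κx≤1 : κ (inj₂ x) ≤ 1) (unused : used U x ≡ false) where

    private
      module S₁ = Scan (κ ⊕ inj₂ x) U
      module S₂ = Scan κ U
      open Transport (κ ⊕ inj₂ x) κ U U
      t = δ 1 (κ (inj₂ x))
      Dₓ = doublesBelow κ x

      below-same : ∀ y → ¬ x <ᶠ y → doublesBelow (κ ⊕ inj₂ x) y ≡ doublesBelow κ y
      below-same y x≮y = trans (doublesBelow-⊕ κ x y κx≤1)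
                               (trans (cong (_ +_) (when-no (x <ᶠ? y) x≮y)) (+-identityʳ _))

      pendingₓ : S₂.pendingAt x ≡ t
      pendingₓ rewrite unused | ∧-identityʳ (κ (inj₂ x) ≡ᵇ 1) = refl

    insert-here : ∀ r {n b h} → n ≡ Dₓ + b → All (x <ᶠ_) (xLetters r) → inj₂ x ∉ r →
                  S₁.BalancedFrom (tally n b true) r → S₂.BalancedFrom (tally n b h) (inj₂ x ∷ r)
    insert-here r {n} {b} n≡ above x∉r bf =
      n≡ ,
      subst₂ (λ p h → S₂.BalancedFrom (tally n (b + p) h) r) (sym pendingₓ) (cong not (sym unused))
        (Equivalence.to (balancedFrom-transport r agree-above (doubles-⊕ κ x κx≤1)
                                                (refl , sym (+-assoc n b t))) bf)
      where
      agree-above = agree-⊕x κ U U x t r κx≤1 x∉r (λ _ _ → refl)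
                      λ z z∈r → when-yes (x <ᶠ? z) (All.lookup above (∈-xLetters r z∈r))

    above-after-excess : ∀ r {n b h} → S₁.BalancedFrom (tally n b h) r → Sorted (xLetters r) → inj₂ x ∉ r →
                         Dₓ + b < n → All (x <ᶠ_) (xLetters r)
    above-after-excess []            _         _      _   _  = []
    above-after-excess (inj₁ a ∷ r) {n} (_ , bf) sorted x∉ lt =
      above-after-excess r bf sorted (x∉ ∘ there) (≤-trans lt (m≤m+n n _))
    above-after-excess (inj₂ y ∷ r) {n} {b} (adm , _) sorted x∉ lt with <ᶠ-cmp y x
    ... | tri< y<x _ _ = ⊥-elim (<⇒≱ lt (begin
          n                                ≡⟨ adm ⟩
          doublesBelow (κ ⊕ inj₂ x) y + b  ≤⟨ +-monoˡ-≤ b (doublesBelow-mono (κ ⊕ inj₂ x) (<⇒≤ y<x)) ⟩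
          doublesBelow (κ ⊕ inj₂ x) x + b  ≡⟨ cong (_+ b) (below-same x (<ᶠ-irrefl refl)) ⟩
          Dₓ + b                           ∎))
      where open ≤-Reasoning
    ... | tri≈ _ refl _ = ⊥-elim (x∉ (here refl))
    ... | tri> _ _ x<y = Linked⇒All <ᶠ-trans x<y sorted

    Insertable : W → Tally → Set
    Insertable r s = ∃₂ λ u v → r ≡ u ++ v × All (_<ᶠ x) (xLetters u) × All (x <ᶠ_) (xLetters v) ×
                                 S₂.BalancedFrom s (u ++ inj₂ x ∷ v)

    private
      absorb-≤ : ∀ {n B} k → n ≤ B → (k ≡ 0 → n ≢ B) → n + δ 0 k ≤ B
      absorb-≤ {n} {B} zero    n≤B n≢B = subst (_≤ B) (+-comm 1 n) (≤∧≢⇒< n≤B (n≢B refl))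
      absorb-≤ {n} {B} (suc k) n≤B _   = subst (_≤ B) (sym (+-identityʳ n)) n≤B

    insertion-exists : ∀ r {s} → Sorted (xLetters r) → inj₂ x ∉ r → S₁.BalancedFrom s r →
                       absorbed s ≤ Dₓ + pending s → Insertable r s
    insertion-exists [] {tally n b h} _ x∉ closed n≤ =
      [] , [] , refl , [] , [] , insert-here [] {h = h} n≡ [] x∉ closed
      where
      n≡ : n ≡ Dₓ + b
      n≡ = ≤-antisym n≤ (subst (Dₓ + b ≤_) (sym closed)
             (+-monoˡ-≤ b (subst (_≤ doubles (κ ⊕ inj₂ x)) (below-same x (<ᶠ-irrefl refl))
                                 (doublesBelow≤doubles (κ ⊕ inj₂ x) x))))
    insertion-exists (inj₂ y ∷ r) {tally n b h} sorted x∉ (adm , bf) n≤ with <ᶠ-cmp y x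
    ... | tri≈ _ refl _ = ⊥-elim (x∉ (here refl))
    ... | tri> _ _ x<y =
      [] , inj₂ y ∷ r , refl , [] , above , insert-here (inj₂ y ∷ r) {h = h} n≡ above x∉ (adm , bf)
      where
      above = Linked⇒All <ᶠ-trans x<y sorted
      n≡ : n ≡ Dₓ + b
      n≡ = ≤-antisym n≤ (subst (Dₓ + b ≤_) (sym adm)
             (+-monoˡ-≤ b (subst (_≤ doublesBelow (κ ⊕ inj₂ x) y) (below-same x (<ᶠ-irrefl refl))
                                 (doublesBelow-mono (κ ⊕ inj₂ x) (<⇒≤ x<y)))))
    ... | tri< y<x _ _
      with u , v , refl , below , above , bf₂ ← insertion-exists r (Linked.tail sorted) (x∉ ∘ there) bf
                                                    (≤-trans n≤ (+-monoʳ-≤ Dₓ (m≤m+n b _))) =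
      inj₂ y ∷ u , v , refl , y<x ∷ below , above ,
      trans adm (cong (_+ b) (below-same y (<ᶠ-asym y<x))) ,
      subst (λ p → S₂.BalancedFrom (tally n (b + p) (not (used U y))) (u ++ inj₂ x ∷ v)) pending≡ bf₂
      where
      pending≡ : S₁.pendingAt y ≡ S₂.pendingAt y
      pending≡ = cong (λ k → if (k ≡ᵇ 1) ∧ not (used U y) then 1 else 0)
                      (⊕-other κ {inj₂ x} λ { refl → <ᶠ-irrefl refl y<x })
    insertion-exists (inj₁ a ∷ r) {tally n b h} sorted x∉ (adm , bf) n≤
      with κ (inj₁ a) ≟ 0 ×-dec n ≟ Dₓ + b
    ... | yes (κa≡0 , n≡) =
      [] , inj₁ a ∷ r , refl , [] , above ,
      insert-here (inj₁ a ∷ r) {h = h} n≡ above x∉ ((λ _ → κa≡0) , bf)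
      where
      above = above-after-excess r bf sorted (x∉ ∘ there)
                (subst (λ k → Dₓ + b < n + δ 0 k) (sym κa≡0)
                       (subst (_< n + 1) n≡ (subst (n <_) (+-comm 1 n) ≤-refl)))
    ... | no not-here
      with u , v , refl , below , above , bf₂
             ← insertion-exists r sorted (x∉ ∘ there) bf
                 (absorb-≤ (κ (inj₁ a)) n≤ (λ κa≡0 n≡ → not-here (κa≡0 , n≡))) =
      inj₁ a ∷ u , v , refl , below , above , adm , bf₂

    private
      absorbed-grows : ∀ m {s} → xLetters m ≡ [] →
                       absorbed s ≤ absorbed (S₂.after s m) × pending (S₂.after s m) ≡ pending s
      absorbed-grows []            _ = ≤-refl , refl
      absorbed-grows (inj₁ a ∷ m) e = let grows , same = absorbed-grows m e in ≤-trans (m≤m+n _ _) grows , same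

      above-prefix : ∀ u v → All (x <ᶠ_) (xLetters (u ++ v)) → All (x <ᶠ_) (xLetters u)
      above-prefix u v above = All-++⁻ˡ (xLetters u) (subst (All (x <ᶠ_)) (xLetters-++ u v) above)

      no-x-letters : ∀ {l} → All (x <ᶠ_) l → All (_<ᶠ x) l → l ≡ []
      no-x-letters []            []            = refl
      no-x-letters (x<y ∷ _) (y<x ∷ _) = ⊥-elim (<ᶠ-asym x<y y<x)

      no-shift : ∀ a m v {s} → xLetters m ≡ [] → S₂.BalancedFrom s (inj₂ x ∷ inj₁ a ∷ m ++ v) →
                 S₂.BalancedFrom s (inj₁ a ∷ m ++ inj₂ x ∷ v) → ⊥
      no-shift a m v {tally n b h} no-x (n≡ , adm-a , _) (_ , bf) =
        <-irrefl refl (begin-strict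
          n                      <⟨ subst (n <_) (cong (λ k → n + δ 0 k) (sym κa≡0))
                                            (subst (n <_) (+-comm 1 n) ≤-refl) ⟩
          n + δ 0 (κ (inj₁ a))   ≤⟨ proj₁ grows ⟩
          absorbed s′            ≡⟨ proj₁ at-x ⟩
          Dₓ + pending s′        ≡⟨ cong (Dₓ +_) (proj₂ grows) ⟩
          Dₓ + b                 ≡⟨ sym n≡ ⟩
          n                      ∎)
        where
        open ≤-Reasoning
        κa≡0 = adm-a (cong not unused)
        split = Equivalence.to (S₂.balancedFrom-++ m (tally (n + δ 0 (κ (inj₁ a))) b false)) bf
        s′ = S₂.after (tally (n + δ 0 (κ (inj₁ a))) b false) m
        at-x = proj₂ split
        grows = absorbed-grows m no-x

    insertion-unique : ∀ u₁ v₁ u₂ v₂ {s} → u₁ ++ v₁ ≡ u₂ ++ v₂ →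
                       All (_<ᶠ x) (xLetters u₁) → All (x <ᶠ_) (xLetters v₁) →
                       All (_<ᶠ x) (xLetters u₂) → All (x <ᶠ_) (xLetters v₂) →
                       S₂.BalancedFrom s (u₁ ++ inj₂ x ∷ v₁) → S₂.BalancedFrom s (u₂ ++ inj₂ x ∷ v₂) →
                       u₁ ≡ u₂
    insertion-unique []            v₁ []            v₂ _    _ _ _ _ _ _ = refl
    insertion-unique []            v₁ (inj₂ y ∷ u₂) v₂ refl _ (x<y ∷ _) (y<x ∷ _) _ _ _ =
      ⊥-elim (<ᶠ-asym x<y y<x)
    insertion-unique []            v₁ (inj₁ a ∷ u₂) v₂ refl _ above₁ below₂ _ bf₁ bf₂ =
      ⊥-elim (no-shift a u₂ v₂ (no-x-letters (above-prefix u₂ v₂ above₁) below₂) bf₁ bf₂)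
    insertion-unique (inj₂ y ∷ u₁) v₁ []            v₂ refl (y<x ∷ _) _ _ (x<y ∷ _) _ _ =
      ⊥-elim (<ᶠ-asym x<y y<x)
    insertion-unique (inj₁ a ∷ u₁) v₁ []            v₂ refl below₁ _ _ above₂ bf₁ bf₂ =
      ⊥-elim (no-shift a u₁ v₁ (no-x-letters (above-prefix u₁ v₁ above₂) below₁) bf₂ bf₁)
    insertion-unique (inj₁ a ∷ u₁) v₁ (inj₁ _ ∷ u₂) v₂ e below₁ above₁ below₂ above₂
                     (_ , bf₁) (_ , bf₂)
      with refl ← ∷-injectiveˡ e =
      cong (inj₁ a ∷_) (insertion-unique u₁ v₁ u₂ v₂ (∷-injectiveʳ e) below₁ above₁ below₂ above₂
                                          bf₁ bf₂)
    insertion-unique (inj₂ y ∷ u₁) v₁ (inj₂ _ ∷ u₂) v₂ e (_ ∷ below₁) above₁ (_ ∷ below₂) above₂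
                     (_ , bf₁) (_ , bf₂)
      with refl ← ∷-injectiveˡ e =
      cong (inj₂ y ∷_) (insertion-unique u₁ v₁ u₂ v₂ (∷-injectiveʳ e) below₁ above₁ below₂ above₂
                                          bf₁ bf₂)
    insertion-unique (inj₁ _ ∷ _) _ (inj₂ _ ∷ _) _ e _ _ _ _ _ _ with () ← ∷-injectiveˡ e
    insertion-unique (inj₂ _ ∷ _) _ (inj₁ _ ∷ _) _ e _ _ _ _ _ _ with () ← ∷-injectiveˡ e

  Fits : Budget → Used → W → L → Set
  Fits κ U w (inj₁ a) = κ (inj₁ a) ≤ 1 × (inj₁ a ∉ w → κ (inj₁ a) ≡ 0)
  Fits κ U w (inj₂ y) = (inj₂ y ∈ w → κ (inj₂ y) ≤ 1) ×
                        (inj₂ y ∉ w → 1 ≤ κ (inj₂ y) × κ (inj₂ y) ≤ 2) ×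
                        (used U y ≡ true → κ (inj₂ y) ≡ 0)

  Shape : Budget → Used → W → Set
  Shape κ U w = ∀ c → Fits κ U w c

  fits-transport : ∀ {κ κ′ U U′ w w′} c → κ c ≡ κ′ c → (c ∈ w ⇔ c ∈ w′) →
                   (∀ {y} → c ≡ inj₂ y → used U y ≡ used U′ y) → Fits κ U w c → Fits κ′ U′ w′ c
  fits-transport (inj₁ a) κ≡ ∈⇔ _ (bound , gone) =
    subst (_≤ 1) κ≡ bound , λ a∉ → trans (sym κ≡) (gone (a∉ ∘ Equivalence.to ∈⇔))
  fits-transport (inj₂ y) κ≡ ∈⇔ used≡ (present , absent , spent) =
    (λ y∈ → subst (_≤ 1) κ≡ (present (Equivalence.from ∈⇔ y∈))) ,
    (λ y∉ → subst (λ k → 1 ≤ k × k ≤ 2) κ≡ (absent (y∉ ∘ Equivalence.to ∈⇔))) ,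
    (λ y-used → trans (sym κ≡) (spent (trans (used≡ refl) y-used)))

  private
    ∈-delete⇔ : ∀ u {c d : L} {v} → d ≢ c → (d ∈ u ++ c ∷ v) ⇔ (d ∈ u ++ v)
    ∈-delete⇔ u d≢c = mk⇔ (λ m → ∈-delete u m d≢c) (∈-insert⁺ u)

    suc≤1 : ∀ {k} → suc k ≤ 1 → k ≡ 0
    suc≤1 (s≤s k≤0) = n≤0⇒n≡0 k≤0

  shape-delete-a : ∀ κ U u v a → κ (inj₁ a) ≡ 0 →
                   Shape (κ ⊕ inj₁ a) U (u ++ inj₁ a ∷ v) ⇔ Shape κ U (u ++ v)
  shape-delete-a κ U u v a κa≡0 = mk⇔ (λ sh d → to d (sh d)) (λ sh d → from d (sh d))
    where
    to : ∀ d → Fits (κ ⊕ inj₁ a) U (u ++ inj₁ a ∷ v) d → Fits κ U (u ++ v) d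
    to d f with d ≟L inj₁ a
    ... | yes refl = subst (_≤ 1) (sym κa≡0) z≤n , λ _ → κa≡0
    ... | no d≢a  = fits-transport d (⊕-other κ (≢-sym d≢a)) (∈-delete⇔ u d≢a) (λ _ → refl) f
    from : ∀ d → Fits κ U (u ++ v) d → Fits (κ ⊕ inj₁ a) U (u ++ inj₁ a ∷ v) d
    from d f with d ≟L inj₁ a
    ... | yes refl = subst (_≤ 1) (sym (trans (⊕-self κ (inj₁ a)) (cong suc κa≡0))) ≤-refl ,
                     λ a∉ → ⊥-elim (a∉ (∈-insert u))
    ... | no d≢a  = fits-transport d (sym (⊕-other κ (≢-sym d≢a))) (⇔-sym (∈-delete⇔ u d≢a))
                                     (λ _ → refl) f

  shape-delete-after-x : ∀ κ U u v y a → κ (inj₂ y) ≡ 0 → κ (inj₁ a) ≡ 0 → used U y ≡ false →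
                         Shape (κ ⊕ inj₂ y) U (u ++ inj₂ y ∷ inj₁ a ∷ v) ⇔
                         Shape κ (y ∷ U) (u ++ inj₂ y ∷ v)
  shape-delete-after-x κ U u v y a κy≡0 κa≡0 unused =
    mk⇔ (λ sh d → to d (letter? d) (sh d)) (λ sh d → from d (letter? d) (sh d))
    where
    w₁ = u ++ inj₂ y ∷ inj₁ a ∷ v
    w₂ = u ++ inj₂ y ∷ v
    data Letter? : L → Set where
      is-a     : Letter? (inj₁ a)
      is-y     : Letter? (inj₂ y)
      other-a  : ∀ {b} → b ≢ a → Letter? (inj₁ b)
      other-x  : ∀ {z} → y ≢ z → Letter? (inj₂ z)
    letter? : ∀ d → Letter? d
    letter? (inj₁ b) with b ≟ᶠ a
    ... | yes refl = is-a
    ... | no b≢a  = other-a b≢a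
    letter? (inj₂ z) with y ≟ᶠ z
    ... | yes refl = is-y
    ... | no y≢z  = other-x y≢z
    κa≤1 = subst (_≤ 1) (sym κa≡0) z≤n
    ∈⇔ : ∀ {d} → d ≢ inj₁ a → (d ∈ w₁) ⇔ (d ∈ w₂)
    ∈⇔ d≢a = subst₂ (λ w w′ → (_ ∈ w) ⇔ (_ ∈ w′))
                    (snoc-assoc u (inj₂ y) (inj₁ a) v) (++-assoc u (inj₂ y ∷ []) v)
                    (∈-delete⇔ (u ++ inj₂ y ∷ []) d≢a)
    to : ∀ d → Letter? d → Fits (κ ⊕ inj₂ y) U w₁ d → Fits κ (y ∷ U) w₂ d
    to _ is-a          _ = κa≤1 , λ _ → κa≡0
    to _ is-y          _ = (λ _ → subst (_≤ 1) (sym κy≡0) z≤n) , (λ y∉ → ⊥-elim (y∉ (∈-insert u))) ,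
                             λ _ → κy≡0
    to _ (other-a b≢a) f = fits-transport {κ ⊕ inj₂ y} {κ} {U} {y ∷ U} {w₁} {w₂} _ refl
                             (∈⇔ (b≢a ∘ inj₁-injective)) (λ ()) f
    to _ (other-x y≢z) f = fits-transport {κ ⊕ inj₂ y} {κ} {U} {y ∷ U} {w₁} {w₂} _
                             (⊕-other κ (y≢z ∘ inj₂-injective)) (∈⇔ λ ())
                             (λ { refl → sym (used-other U y≢z) }) f
    from : ∀ d → Letter? d → Fits κ (y ∷ U) w₂ d → Fits (κ ⊕ inj₂ y) U w₁ d
    from _ is-a          _ = κa≤1 , λ _ → κa≡0
    from _ is-y          _ = (λ _ → subst (_≤ 1) (sym (trans (⊕-self κ (inj₂ y)) (cong suc κy≡0))) ≤-refl) ,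
                             (λ y∉ → ⊥-elim (y∉ (∈-insert u))) ,
                             λ y-used → ⊥-elim (false≢true (trans (sym unused) y-used))
    from _ (other-a b≢a) f = fits-transport {κ} {κ ⊕ inj₂ y} {y ∷ U} {U} {w₂} {w₁} _ refl
                               (⇔-sym (∈⇔ (b≢a ∘ inj₁-injective))) (λ ()) f
    from _ (other-x y≢z) f = fits-transport {κ} {κ ⊕ inj₂ y} {y ∷ U} {U} {w₂} {w₁} _
                               (sym (⊕-other κ (y≢z ∘ inj₂-injective))) (⇔-sym (∈⇔ λ ()))
                               (λ { refl → used-other U y≢z }) f

  shape-insert-x : ∀ κ U u v x → κ (inj₂ x) ≤ 1 → used U x ≡ false → inj₂ x ∉ u ++ v →
                   Shape (κ ⊕ inj₂ x) U (u ++ v) ⇔ Shape κ U (u ++ inj₂ x ∷ v)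
  shape-insert-x κ U u v x κx≤1 unused x∉ = mk⇔ (λ sh d → to d (sh d)) (λ sh d → from d (sh d))
    where
    to : ∀ d → Fits (κ ⊕ inj₂ x) U (u ++ v) d → Fits κ U (u ++ inj₂ x ∷ v) d
    to d f with d ≟L inj₂ x
    ... | yes refl = (λ _ → κx≤1) , (λ x∉′ → ⊥-elim (x∉′ (∈-insert u))) ,
                     λ x-used → ⊥-elim (false≢true (trans (sym unused) x-used))
    ... | no d≢x  = fits-transport d (⊕-other κ (≢-sym d≢x)) (⇔-sym (∈-delete⇔ u d≢x)) (λ _ → refl) f
    from : ∀ d → Fits κ U (u ++ inj₂ x ∷ v) d → Fits (κ ⊕ inj₂ x) U (u ++ v) d
    from d f with d ≟L inj₂ x
    ... | yes refl = (λ x∈ → ⊥-elim (x∉ x∈)) ,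
                     (λ _ → subst (λ k → 1 ≤ k × k ≤ 2) (sym (⊕-self κ (inj₂ x)))
                                  (s≤s z≤n , s≤s κx≤1)) ,
                     λ x-used → ⊥-elim (false≢true (trans (sym unused) x-used))
    ... | no d≢x  = fits-transport d (sym (⊕-other κ (≢-sym d≢x))) (∈-delete⇔ u d≢x) (λ _ → refl) f

  Feasible : Budget → Used → W → Set
  Feasible κ U w = Shape κ U w × Scan.Balanced κ U w

  feasible-backward : ∀ {κ U w w′ c U′} → Step U w w′ c U′ → Consistent U w → IsShuffle w′ →
                      Feasible κ U′ w′ → Feasible (κ ⊕ c) U w
  feasible-backward {κ} {U} (delete-a u v a refl refl not-free) ((uniq , _) , _) _ (sh , bal) =
    Equivalence.from (shape-delete-a κ U u v a κa≡0) sh ,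
    Equivalence.from (balanced-delete-a κ U u v a κa≡0 a∉ not-free) bal
    where
    a∉ = Unique-∉ u uniq
    κa≡0 = proj₂ (sh (inj₁ a)) a∉
  feasible-backward {κ} {U} (delete-after-x u v y a refl refl unused) ((uniq , _) , _) _ (sh , bal) =
    Equivalence.from (shape-delete-after-x κ U u v y a κy≡0 κa≡0 unused) sh ,
    Equivalence.from (balanced-delete-after-x κ U u v y a κy≡0 κa≡0 y∉ unused) bal
    where
    κy≡0 = proj₂ (proj₂ (sh (inj₂ y))) (used-self U y)
    a∉ : inj₁ a ∉ u ++ inj₂ y ∷ v
    a∉ = subst (inj₁ a ∉_) (++-assoc u (inj₂ y ∷ []) v)
           (Unique-∉ (u ++ inj₂ y ∷ []) (subst Unique (sym (snoc-assoc u (inj₂ y) (inj₁ a) v)) uniq))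
    κa≡0 = proj₂ (sh (inj₁ a)) a∉
    y∉ = Unique-∉ u uniq ∘ ∈-insert⁺ u
  feasible-backward {κ} {U} (insert-x u v x refl refl) cons sw′ (sh , bal) =
    Equivalence.from (shape-insert-x κ U u v x κx≤1 unused x∉) sh ,
    balanced-insert-x κ U u v x κx≤1 unused below above x∉ bal
    where
    x∉ = Unique-∉ u (proj₁ sw′)
    κx≤1 = proj₁ (sh (inj₂ x)) (∈-insert u)
    unused = unused-if-absent {U} cons x∉
    below = proj₁ (shuffle-split-x u sw′)
    above = proj₂ (shuffle-split-x u sw′)

  module _ {κ : Budget} {U : Used} {w : W} where

    shape-⊕a : ∀ {a} → Shape (κ ⊕ inj₁ a) U w → κ (inj₁ a) ≡ 0
    shape-⊕a {a} sh = suc≤1 (subst (_≤ 1) (⊕-self κ (inj₁ a)) (proj₁ (sh (inj₁ a))))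

    shape-⊕a-present : ∀ {a} → Shape (κ ⊕ inj₁ a) U w → inj₁ a ∉ w → ⊥
    shape-⊕a-present {a} sh a∉w = 0≢1+n (trans (sym (proj₂ (sh (inj₁ a)) a∉w)) (⊕-self κ (inj₁ a)))

    shape-⊕x-present : ∀ {y} → Shape (κ ⊕ inj₂ y) U w → inj₂ y ∈ w → κ (inj₂ y) ≡ 0
    shape-⊕x-present {y} sh y∈w = suc≤1 (subst (_≤ 1) (⊕-self κ (inj₂ y)) (proj₁ (sh (inj₂ y)) y∈w))

    shape-⊕x-absent : ∀ {y} → Shape (κ ⊕ inj₂ y) U w → inj₂ y ∉ w → κ (inj₂ y) ≤ 1
    shape-⊕x-absent {y} sh y∉w =
      ≤-pred (subst (_≤ 2) (⊕-self κ (inj₂ y)) (proj₂ (proj₁ (proj₂ (sh (inj₂ y))) y∉w)))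

    shape-⊕x-unused : ∀ {y} → Shape (κ ⊕ inj₂ y) U w → used U y ≡ false
    shape-⊕x-unused {y} sh =
      ¬-not λ y-used → 0≢1+n (trans (sym (proj₂ (proj₂ (sh (inj₂ y))) y-used)) (⊕-self κ (inj₂ y)))

  feasible-forward : ∀ {κ U w} c → Consistent U w → Feasible (κ ⊕ c) U w →
                     ∃₂ λ w′ U′ → Step U w w′ c U′ × IsShuffle w′ × Feasible κ U′ w′
  feasible-forward {κ} {U} {w} (inj₁ a) (sw , _) (sh , bal) with inj₁ a ∈L? w
  ... | no a∉w = ⊥-elim (shape-⊕a-present sh a∉w)
  ... | yes a∈w with u , v , refl ← ∈-∃++ a∈w =
    u ++ v , U , delete-a u v a refl refl not-free , shuffle-delete-a u sw ,
    Equivalence.to (shape-delete-a κ U u v a κa≡0) sh ,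
    Equivalence.to (balanced-delete-a κ U u v a κa≡0 (Unique-∉ u (proj₁ sw)) not-free) bal
    where
    κa≡0 = shape-⊕a sh
    not-free = balanced-not-free-before-a κ U u v a bal
  feasible-forward {κ} {U} {w} (inj₂ y) (sw , _) (sh , bal) with inj₂ y ∈L? w
  ... | yes y∈w
    with u , r , refl ← ∈-∃++ y∈w
    with a , v , refl , κa≡0
           ← balanced-after-x-is-a κ U u r y (shape-⊕x-present sh y∈w) (shape-⊕x-unused sh)
                                   (proj₂ (shuffle-split-x u sw)) bal =
    u ++ inj₂ y ∷ v , y ∷ U , delete-after-x u v y a refl refl unused , shuffle-delete-after-x u sw ,
    Equivalence.to (shape-delete-after-x κ U u v y a κy≡0 κa≡0 unused) sh ,
    Equivalence.to (balanced-delete-after-x κ U u v y a κy≡0 κa≡0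
                      (Unique-∉ u (proj₁ sw) ∘ ∈-insert⁺ u) unused) bal
    where
    κy≡0 = shape-⊕x-present sh y∈w
    unused = shape-⊕x-unused sh
  ... | no y∉w
    with u , v , refl , below , above , bal′
           ← Insertion.insertion-exists κ U y (shape-⊕x-absent sh y∉w) (shape-⊕x-unused sh)
                                        w (proj₂ (proj₂ sw)) y∉w bal z≤n =
    u ++ inj₂ y ∷ v , U , insert-x u v y refl refl , shuffle-insert-x u sw y∉w below above ,
    Equivalence.to (shape-insert-x κ U u v y (shape-⊕x-absent sh y∉w) (shape-⊕x-unused sh) y∉w) sh ,
    bal′

  feasible-step-unique : ∀ {κ U w w₁ w₂ c U₁ U₂} → Step U w w₁ c U₁ → Step U w w₂ c U₂ →
                         Consistent U w → IsShuffle w₁ → IsShuffle w₂ →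
                         Feasible κ U₁ w₁ → Feasible κ U₂ w₂ → w₁ ≡ w₂ × U₁ ≡ U₂
  feasible-step-unique (delete-a u₁ v₁ a w≡₁ refl _) (delete-a u₂ v₂ _ w≡₂ refl _) ((uniq , _) , _) _ _ _ _
    with refl , refl ← Unique-split u₁ u₂ (subst Unique w≡₁ uniq) (trans (sym w≡₁) w≡₂) = refl , refl
  feasible-step-unique (delete-after-x u₁ v₁ y _ w≡₁ refl _) (delete-after-x u₂ v₂ _ _ w≡₂ refl _)
                       ((uniq , _) , _) _ _ _ _
    with refl , v≡ ← Unique-split u₁ u₂ (subst Unique w≡₁ uniq) (trans (sym w≡₁) w≡₂)
    with refl ← ∷-injectiveʳ v≡ = refl , refl
  feasible-step-unique (delete-after-x u₁ v₁ y a w≡₁ refl _) (insert-x u₂ v₂ _ w≡₂ refl) _ _ sw₂ _ _ =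
    ⊥-elim (Unique-∉ u₂ (proj₁ sw₂) (subst (inj₂ y ∈_) (trans (sym w≡₁) w≡₂) (∈-insert u₁)))
  feasible-step-unique (insert-x u₁ v₁ y w≡₁ refl) (delete-after-x u₂ v₂ _ a w≡₂ refl _) _ sw₁ _ _ _ =
    ⊥-elim (Unique-∉ u₁ (proj₁ sw₁) (subst (inj₂ y ∈_) (trans (sym w≡₂) w≡₁) (∈-insert u₂)))
  feasible-step-unique {κ} {U} (insert-x u₁ v₁ x w≡₁ refl) (insert-x u₂ v₂ _ w≡₂ refl)
                       cons sw₁ sw₂ (sh₁ , bal₁) (_ , bal₂)
    with refl ← Insertion.insertion-unique κ U x (proj₁ (sh₁ (inj₂ x)) (∈-insert u₁))
                  (unused-if-absent {U} cons (Unique-∉ u₁ (proj₁ sw₁) ∘ subst (inj₂ x ∈_) w≡₁))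
                  u₁ v₁ u₂ v₂ (trans (sym w≡₁) w≡₂)
                  (proj₁ (shuffle-split-x u₁ sw₁)) (proj₂ (shuffle-split-x u₁ sw₁))
                  (proj₁ (shuffle-split-x u₂ sw₂)) (proj₂ (shuffle-split-x u₂ sw₂)) bal₁ bal₂
    with refl ← ++-cancelˡ u₁ v₁ v₂ (trans (sym w≡₁) w≡₂) = refl , refl

  -- Chains

  private
    κ₀ : Budget
    κ₀ = count []

    doubles-κ₀ : doubles κ₀ ≡ 0
    doubles-κ₀ = sum-replicate-zero N

    doublesBelow-κ₀ : ∀ y → doublesBelow κ₀ y ≡ 0
    doublesBelow-κ₀ y = n≤0⇒n≡0 (subst (doublesBelow κ₀ y ≤_) doubles-κ₀ (doublesBelow≤doubles κ₀ y))

  feasible-top : ∀ U → Feasible κ₀ U (top M N)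
  feasible-top U = shape , all-x (allFin N) refl
    where
    shape : Shape κ₀ U (top M N)
    shape (inj₁ a) = z≤n , λ _ → refl
    shape (inj₂ y) = (λ _ → z≤n) , (λ y∉ → ⊥-elim (y∉ (∈-map⁺ inj₂ (∈-allFin y)))) , λ _ → refl
    all-x : ∀ ys {b h} → b ≡ 0 → Scan.BalancedFrom κ₀ U (tally 0 b h) (map inj₂ ys)
    all-x []       refl = sym (cong (_+ 0) doubles-κ₀)
    all-x (y ∷ ys) refl = sym (cong (_+ 0) (doublesBelow-κ₀ y)) , all-x ys refl

  feasible-κ₀⇒top : ∀ {U w} → Consistent U w → Feasible κ₀ U w → w ≡ top M N
  feasible-κ₀⇒top {U} {w} ((_ , _ , sorted) , _) (sh , bal) = begin
    w                         ≡⟨ only-x w (proj₂ (no-a w refl bal)) ⟩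
    map inj₂ (xLetters w)     ≡⟨ cong (map inj₂) (Linked-≡ <ᶠ-trans (<ᶠ-irrefl refl) sorted (allFin-sorted N)
                                                     (λ _ → ∈-allFin _) (λ {y} _ → ∈-xLetters w (present y))) ⟩
    map inj₂ (allFin N)       ∎
    where
    open ≡-Reasoning
    present : ∀ y → inj₂ y ∈ w
    present y with inj₂ y ∈L? w
    ... | yes y∈w = y∈w
    ... | no y∉w  with () ← proj₁ (proj₁ (proj₂ (sh (inj₂ y))) y∉w)
    no-a : ∀ w {n b h} → b ≡ 0 → Scan.BalancedFrom κ₀ U (tally n b h) w → n ≡ 0 × aLetters w ≡ []
    no-a []            refl closed    = trans closed (cong (_+ 0) doubles-κ₀) , refl
    no-a (inj₁ a ∷ w) {n} refl (_ , bf) = ⊥-elim (0≢1+n (sym (trans (+-comm 1 n) (proj₁ (no-a w refl bf)))))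
    no-a (inj₂ y ∷ w) refl (_ , bf)   = no-a w refl bf
    only-x : ∀ w → aLetters w ≡ [] → w ≡ map inj₂ (xLetters w)
    only-x []            _  = refl
    only-x (inj₂ y ∷ w) no-a-letters = cong (inj₂ y ∷_) (only-x w no-a-letters)

  ChainToTop : W → List W → Set
  ChainToTop w ws = Saturated (w ∷ ws) × last (w ∷ ws) ≡ just (top M N)

  chain-feasible : ∀ ws {U w} → Consistent U w → ChainToTop w ws → Feasible (count (labelsFrom U w ws)) U w
  chain-feasible []        cons (single , refl) = feasible-top _
  chain-feasible (w′ ∷ ws) {U} cons (step cov@(sw , sw′ , _) sat , lst)
    with c , U′ , st ← cover⇒step U cov
    rewrite labelsFrom-step ws st sw sw′ =
    feasible-backward st cons sw′ (chain-feasible ws (step-consistent st cons sw′) (sat , lst))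

  chain-exists : ∀ l {U w} → Consistent U w → Feasible (count l) U w →
                 ∃ λ ws → ChainToTop w ws × labelsFrom U w ws ≡ l
  chain-exists []      cons fe = [] , (single , cong just (feasible-κ₀⇒top cons fe)) , refl
  chain-exists (c ∷ l) cons fe
    with w′ , U′ , st , sw′ , fe′ ← feasible-forward c cons fe
    with ws , (sat , lst) , labels ← chain-exists l (step-consistent st cons sw′) fe′ =
    w′ ∷ ws , (step (step⇒cover st (proj₁ cons) sw′) sat , lst) ,
    trans (labelsFrom-step ws st (proj₁ cons) sw′) (cong (c ∷_) labels)

  chain-unique : ∀ ws₁ ws₂ {U w} → Consistent U w → ChainToTop w ws₁ → ChainToTop w ws₂ →
                 labelsFrom U w ws₁ ≡ labelsFrom U w ws₂ → ws₁ ≡ ws₂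
  chain-unique []          []          _    _ _ _ = refl
  chain-unique []          (w₂ ∷ ws₂) {U} cons _ (step cov₂ _ , _) labels
    with _ , _ , st₂ ← cover⇒step U cov₂
    with () ← trans labels (labelsFrom-step ws₂ st₂ (proj₁ cov₂) (proj₁ (proj₂ cov₂)))
  chain-unique (w₁ ∷ ws₁) []          {U} cons (step cov₁ _ , _) _ labels
    with _ , _ , st₁ ← cover⇒step U cov₁
    with () ← trans (sym labels) (labelsFrom-step ws₁ st₁ (proj₁ cov₁) (proj₁ (proj₂ cov₁)))
  chain-unique (w₁ ∷ ws₁) (w₂ ∷ ws₂) {U} cons (step cov₁@(sw , sw₁ , _) sat₁ , lst₁)
                                             (step cov₂@(_ , sw₂ , _) sat₂ , lst₂) labels
    with _ , _ , st₁ ← cover⇒step U cov₁ | _ , _ , st₂ ← cover⇒step U cov₂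
    with refl , tails ← ∷-injective (trans (sym (labelsFrom-step ws₁ st₁ sw sw₁))
                                          (trans labels (labelsFrom-step ws₂ st₂ sw sw₂)))
    with refl , refl ← feasible-step-unique st₁ st₂ cons sw₁ sw₂
                         (chain-feasible ws₁ (step-consistent st₁ cons sw₁) (sat₁ , lst₁))
                         (subst (λ l → Feasible (count l) _ w₂) (sym tails)
                                (chain-feasible ws₂ (step-consistent st₂ cons sw₂) (sat₂ , lst₂))) =
    cong (w₁ ∷_) (chain-unique ws₁ ws₂ (step-consistent st₁ cons sw₁) (sat₁ , lst₁) (sat₂ , lst₂) tails)

  -- Feasibility at the bottom

  count-map-elems : ∀ {n} (g : Fin n → L) → (∀ {i j} → g i ≡ g j → i ≡ j) →
                    ∀ p i → count (map g (elems p)) (g i) ≡ 𝟙[ i ∈ p ]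
  count-map-elems {n} g g-inj p i with i ∈? p
  ... | yes i∈p = count-unique (Unique.map⁺ g-inj (Unique.filter⁺ (_∈? p) (Unique.allFin⁺ n)))
                               (∈-map⁺ g (∈-filter⁺ (_∈? p) (∈-allFin i) i∈p))
  ... | no i∉p = count-∉ (map g (elems p)) λ gi∈ → let j , j∈ , gi≡gj = ∈-map⁻ g gi∈ in
                   i∉p (subst (_∈ˢ p) (sym (g-inj gi≡gj)) (proj₂ (∈-filter⁻ (_∈? p) {xs = allFin n} j∈)))

  count-map-other : ∀ {n} (g : Fin n → L) l {d} → (∀ i → g i ≢ d) → count (map g l) d ≡ 0
  count-map-other g l g≢d = count-∉ (map g l) λ d∈ → let i , _ , d≡gi = ∈-map⁻ g d∈ in g≢d i (sym d≡gi)

  private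
    count-multiset : ∀ A X d → count (multisetList A X) d ≡
                     count (map inj₁ (elems A)) d + (count (map inj₂ (elems X)) d +
                       (count (map inj₂ (elems X)) d + count (map inj₂ (elems (∁ X))) d))
    count-multiset A X d =
      trans (count-++ eA _ d) (cong (count eA d +_) (trans (count-++ eX _ d) (cong (count eX d +_) (count-++ eX eC d))))
      where
      eA = map inj₁ (elems A)
      eX = map inj₂ (elems X)
      eC = map inj₂ (elems (∁ X))

  count-multiset-a : ∀ A X a → count (multisetList A X) (inj₁ a) ≡ 𝟙[ a ∈ A ]
  count-multiset-a A X a =
    trans (count-multiset A X (inj₁ a))
          (cong₂ _+_ (count-map-elems inj₁ inj₁-injective A a)
                     (cong₂ _+_ (not-x (elems X)) (cong₂ _+_ (not-x (elems X)) (not-x (elems (∁ X)))))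
           ∙ +-identityʳ _)
    where
    not-x : ∀ l → count (map inj₂ l) (inj₁ a) ≡ 0
    not-x l = count-map-other inj₂ l λ _ ()
    _∙_ = trans

  count-multiset-x : ∀ A X y →
                     count (multisetList A X) (inj₂ y) ≡ 𝟙[ y ∈ X ] + (𝟙[ y ∈ X ] + 𝟙[ y ∈ ∁ X ])
  count-multiset-x A X y =
    trans (count-multiset A X (inj₂ y))
          (cong₂ _+_ (count-map-other inj₁ (elems A) λ _ ())
                     (cong₂ _+_ (count-map-elems inj₂ inj₂-injective X y)
                                (cong₂ _+_ (count-map-elems inj₂ inj₂-injective X y)
                                           (count-map-elems inj₂ inj₂-injective (∁ X) y))))

  Profile : Budget → Set
  Profile κ = (∀ a → κ (inj₁ a) ≤ 1) × (∀ y → 1 ≤ κ (inj₂ y) × κ (inj₂ y) ≤ 2) ×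
              sum (λ a → δ 0 (κ (inj₁ a))) ≡ doubles κ

  feasible-bot⇔profile : ∀ κ → Feasible κ [] (bot M N) ⇔ Profile κ
  feasible-bot⇔profile κ = mk⇔
    (λ (sh , bal) → (λ a → proj₁ (sh (inj₁ a))) , (λ y → proj₁ (proj₂ (sh (inj₂ y))) (x∉bot y)) ,
                    Equivalence.to balanced-bot bal)
    (λ (a-bounds , x-bounds , balance) → shape a-bounds x-bounds , Equivalence.from balanced-bot balance)
    where
    x∉bot : ∀ y → inj₂ y ∉ bot M N
    x∉bot y y∈ with _ , _ , () ← ∈-map⁻ inj₁ y∈
    shape : (∀ a → κ (inj₁ a) ≤ 1) → (∀ y → 1 ≤ κ (inj₂ y) × κ (inj₂ y) ≤ 2) →
            Shape κ [] (bot M N)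
    shape a-bounds x-bounds (inj₁ a) = a-bounds a , λ a∉ → ⊥-elim (a∉ (∈-map⁺ inj₁ (∈-allFin a)))
    shape a-bounds x-bounds (inj₂ y) = (λ y∈ → ⊥-elim (x∉bot y y∈)) , (λ _ → x-bounds y) , λ ()
    absorbed-in : List (Fin M) → ℕ
    absorbed-in l = sumˡ (map (λ a → δ 0 (κ (inj₁ a))) l)
    balanced-a-word : ∀ l n → Scan.BalancedFrom κ [] (tally n 0 false) (map inj₁ l) ⇔
                              (n + absorbed-in l ≡ doubles κ + 0)
    balanced-a-word []      n = mk⇔ (trans (+-identityʳ n)) (trans (sym (+-identityʳ n)))
    balanced-a-word (a ∷ l) n = mk⇔
      (λ (_ , bf) → trans (sym (+-assoc n _ _)) (Equivalence.to rest bf))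
      (λ eq → (λ ()) , Equivalence.from rest (trans (+-assoc n _ _) eq))
      where rest = balanced-a-word l (n + δ 0 (κ (inj₁ a)))
    balanced-bot : Scan.Balanced κ [] (bot M N) ⇔ (sum (λ a → δ 0 (κ (inj₁ a))) ≡ doubles κ)
    balanced-bot = ⇔-trans (balanced-a-word (allFin M) 0)
      (mk⇔ (λ eq → trans (sym (sum-allFin absorbs)) (trans eq (+-identityʳ _)))
           (λ eq → trans (sum-allFin absorbs) (trans eq (sym (+-identityʳ _)))))
      where
      absorbs : Fin M → ℕ
      absorbs a = δ 0 (κ (inj₁ a))

  profile⇒image : ∀ ℓ → Profile (count ℓ) → InImage M N ℓ
  profile⇒image ℓ (a-bounds , x-bounds , balance) = A , X , card , ↭-count ℓ (multisetList A X) counts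
    where
    κ = count ℓ
    A = tabulate λ a → κ (inj₁ a) ≡ᵇ 1
    X = tabulate λ y → κ (inj₂ y) ≡ᵇ 2
    𝟙A : ∀ a → 𝟙[ a ∈ A ] ≡ δ 1 (κ (inj₁ a))
    𝟙A a = cong (λ b → if b then 1 else 0) (∈?-tabulate _ a)
    𝟙X : ∀ y → 𝟙[ y ∈ X ] ≡ δ 2 (κ (inj₂ y))
    𝟙X y = cong (λ b → if b then 1 else 0) (∈?-tabulate _ y)
    a-count : ∀ {k} → k ≤ 1 → δ 1 k ≡ k
    a-count {zero}  _ = refl
    a-count {suc zero} _ = refl
    a-count {suc (suc _)} (s≤s ())
    x-count : ∀ {k} → 1 ≤ k × k ≤ 2 → δ 2 k + (δ 2 k + δ 0 (δ 2 k)) ≡ k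
    x-count {suc zero} _ = refl
    x-count {suc (suc zero)} _ = refl
    x-count {suc (suc (suc _))} (_ , s≤s (s≤s ()))
    counts : ∀ d → κ d ≡ count (multisetList A X) d
    counts (inj₁ a) = sym (trans (count-multiset-a A X a) (trans (𝟙A a) (a-count (a-bounds a))))
    counts (inj₂ y) = sym (begin
      count (multisetList A X) (inj₂ y)                 ≡⟨ count-multiset-x A X y ⟩
      𝟙[ y ∈ X ] + (𝟙[ y ∈ X ] + 𝟙[ y ∈ ∁ X ])          ≡⟨ cong (λ k → 𝟙[ y ∈ X ] + (𝟙[ y ∈ X ] + k)) (𝟙-∁ X y) ⟩
      𝟙[ y ∈ X ] + (𝟙[ y ∈ X ] + δ 0 𝟙[ y ∈ X ])        ≡⟨ cong (λ k → k + (k + δ 0 k)) (𝟙X y) ⟩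
      δ 2 (κ (inj₂ y)) + (δ 2 (κ (inj₂ y)) + δ 0 (δ 2 (κ (inj₂ y)))) ≡⟨ x-count (x-bounds y) ⟩
      κ (inj₂ y)                                        ∎)
      where open ≡-Reasoning
    card : ∣ A ∣ + ∣ X ∣ ≡ M
    card = begin
      ∣ A ∣ + ∣ X ∣                        ≡⟨ cong₂ _+_ (trans (∣p∣≡∑𝟙 A) (sum-cong-≗ 𝟙A))
                                                        (trans (∣p∣≡∑𝟙 X) (sum-cong-≗ 𝟙X)) ⟩
      sum once + doubles κ                 ≡⟨ cong (sum once +_) (sym balance) ⟩
      sum once + sum deleted-by-x              ≡⟨ sym (∑-distrib-+ once deleted-by-x) ⟩
      sum (λ a → once a + deleted-by-x a)      ≡⟨ sum-cong-≗ (λ a → one (a-bounds a)) ⟩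
      sum {M} (λ _ → 1)                    ≡⟨ sum-ones M ⟩
      M                                    ∎
      where
      open ≡-Reasoning
      once deleted-by-x : Fin M → ℕ
      once a = δ 1 (κ (inj₁ a))
      deleted-by-x a = δ 0 (κ (inj₁ a))
      one : ∀ {k} → k ≤ 1 → δ 1 k + δ 0 k ≡ 1
      one {zero}  _ = refl
      one {suc zero} _ = refl
      one {suc (suc _)} (s≤s ())

  image⇒profile : ∀ ℓ → InImage M N ℓ → Profile (count ℓ)
  image⇒profile ℓ (A , X , card , perm) = a-bounds , x-bounds , balance
    where
    κ = count ℓ
    κ≡ = count-↭ perm
    κa≡ : ∀ a → κ (inj₁ a) ≡ 𝟙[ a ∈ A ]
    κa≡ a = trans (κ≡ (inj₁ a)) (count-multiset-a A X a)
    κy≡ : ∀ y → κ (inj₂ y) ≡ 𝟙[ y ∈ X ] + (𝟙[ y ∈ X ] + δ 0 𝟙[ y ∈ X ])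
    κy≡ y = trans (κ≡ (inj₂ y))
                  (trans (count-multiset-x A X y) (cong (λ k → 𝟙[ y ∈ X ] + (𝟙[ y ∈ X ] + k)) (𝟙-∁ X y)))
    once-or-twice : ∀ {b} → b ≤ 1 →
                    (1 ≤ b + (b + δ 0 b) × b + (b + δ 0 b) ≤ 2) × δ 2 (b + (b + δ 0 b)) ≡ b
    once-or-twice {zero}  _ = (s≤s z≤n , s≤s z≤n) , refl
    once-or-twice {suc zero} _ = (s≤s z≤n , ≤-refl) , refl
    once-or-twice {suc (suc _)} (s≤s ())
    a-bounds : ∀ a → κ (inj₁ a) ≤ 1
    a-bounds a = subst (_≤ 1) (sym (κa≡ a)) (𝟙≤1 A a)
    x-bounds : ∀ y → 1 ≤ κ (inj₂ y) × κ (inj₂ y) ≤ 2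
    x-bounds y = subst (λ k → 1 ≤ k × k ≤ 2) (sym (κy≡ y)) (proj₁ (once-or-twice (𝟙≤1 X y)))
    balance : sum (λ a → δ 0 (κ (inj₁ a))) ≡ doubles κ
    balance = begin
      sum (λ a → δ 0 (κ (inj₁ a)))  ≡⟨ sum-cong-≗ (λ a → trans (cong (δ 0) (κa≡ a))
                                                                (sym (𝟙-∁ A a))) ⟩
      sum (λ a → 𝟙[ a ∈ ∁ A ])      ≡⟨ sym (∣p∣≡∑𝟙 (∁ A)) ⟩
      ∣ ∁ A ∣                       ≡⟨ ∣∁p∣≡n∸∣p∣ A ⟩
      M ∸ ∣ A ∣                     ≡⟨ cong (_∸ ∣ A ∣) (sym card) ⟩
      ∣ A ∣ + ∣ X ∣ ∸ ∣ A ∣         ≡⟨ m+n∸m≡n ∣ A ∣ ∣ X ∣ ⟩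
      ∣ X ∣                         ≡⟨ ∣p∣≡∑𝟙 X ⟩
      sum (λ y → 𝟙[ y ∈ X ])        ≡⟨ sum-cong-≗ (λ y → sym (trans (cong (δ 2) (κy≡ y))
                                                                 (proj₂ (once-or-twice (𝟙≤1 X y))))) ⟩
      doubles κ                     ∎
      where open ≡-Reasoning

lemma3p1 : (M N : ℕ) →
    ((ws ws' : List (Word M N)) → IsMaxChain M N ws → IsMaxChain M N ws' →
       Λ ws ≡ Λ ws' → ws ≡ ws')
    × ((ℓ : List (Letter M N)) →
       (Σ (List (Word M N)) (λ ws → IsMaxChain M N ws × (Λ ws ≡ ℓ))) ⇔ InImage M N ℓ)
lemma3p1 M N = injective , image
  where
  open Multiplicity (_≟L_ {M} {N})

  injective : ∀ ws ws′ → IsMaxChain M N ws → IsMaxChain M N ws′ → Λ ws ≡ Λ ws′ → ws ≡ ws′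
  injective (_ ∷ ws) (_ ∷ ws′) (refl , last≡ , sat) (refl , last≡′ , sat′) labels =
    cong (bot M N ∷_) (chain-unique M N ws ws′ (consistent-bot M N) (sat , last≡) (sat′ , last≡′) labels)

  chains⇔feasible : ∀ ℓ → (Σ (List (Word M N)) λ ws → IsMaxChain M N ws × Λ ws ≡ ℓ) ⇔
                          Feasible M N (count ℓ) [] (bot M N)
  chains⇔feasible ℓ = mk⇔
    (λ { (_ ∷ ws , (refl , last≡ , sat) , refl) → chain-feasible M N ws (consistent-bot M N) (sat , last≡) })
    (λ feasible → let ws , (sat , last≡) , labels = chain-exists M N ℓ (consistent-bot M N) feasible
                  in bot M N ∷ ws , (refl , last≡ , sat) , labels)

  image : ∀ ℓ → (Σ (List (Word M N)) λ ws → IsMaxChain M N ws × Λ ws ≡ ℓ) ⇔ InImage M N ℓ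
  image ℓ = ⇔-trans (chains⇔feasible ℓ)
              (⇔-trans (feasible-bot⇔profile M N (count ℓ))
                       (mk⇔ (profile⇒image M N ℓ) (image⇒profile M N ℓ)))
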